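{- For $m\geq2$ let $\acute{G}_{m}(t,x)=\sum_{\mu}t^{\mathrm{la}(\mu)}x^{\mathrm{size}(\mu)}$, the sum over all augmented $m$-Dyck paths $\mu$ (including the empty path), and for $k\geq1$ let $\acute{F}_{k}(t,x)=\sum_{\mu}t^{\mathrm{la}(\mu)}x^{\mathrm{size}(\mu)}$, the sum over all $k$-box paths $\mu$ of size at least $1$, where $\mathrm{la}(\mu)$ is the number of long ascents of $\mu$. Then for every $m\geq2$, \[\acute{G}_{m}=1+x\acute{G}_{m}^{m}(\acute{G}_{m}-1+t),\] and for every $k\geq1$, \[\acute{F}_{k}=x\acute{G}_{k+1}^{k}(\acute{G}_{k+1}-1+t).\]
   Context: A skew Dyck path is a word $w$ over $\{U,D,L\}$ such that: $w$ contains neither $UL$ nor $LU$ as a contiguous subword; the number of $U$s equals the total number of $D$s and $L$s; and in every prefix the total number of $D$s and $L$s is at most the number of $U$s. Its semilength is its number of $U$s. A factor is a contiguous subword; $X^{m}$ denotes $m$ consecutive copies of $X$. For $k\geq1$, a $k$-box path of size $n$ is a skew Dyck path of semilength $(k+2)n-1$ containing exactly $n$ occurrences of the factor $UD^{k}L$. For $m\geq2$, an augmented $m$-Dyck path of size $n$ is a skew Dyck path of the form $U^{a_{1}}D^{m-1}LD\,U^{a_{2}}D^{m-1}LD\cdots U^{a_{n}}D^{m-1}LD$ with positive integers $a_{1},\dots,a_{n}$ (the empty path when $n=0$); equivalently, it is obtained from a lattice path with steps $(1,1)$ and $(m,-m)$ from $(0,0)$ to $(2mn,0)$ never going below the $x$-axis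 by writing $(1,1)$ as $U$ and replacing each $(m,-m)$ step by $UD^{m-1}LD$. An ascent is a maximal run of consecutive $U$s; a long ascent is an ascent consisting of at least two $U$s. -}

module Defs where

open import Data.Bool using (Bool; true; false; _∧_; not; if_then_else_)
open import Data.Nat using (ℕ; zero; suc; _+_; _*_; _∸_; _≤ᵇ_; _≡ᵇ_)
open import Data.List using (List; []; _∷_; _++_; replicate; length; filterᵇ; concatMap)
open import Data.Product using (_×_; _,_)
open import Data.Maybe using (Maybe; just; nothing)
open import Data.Integer using (ℤ; +_) renaming (_+_ to _+ℤ_; _*_ to _*ℤ_; _-_ to _-ℤ_)

data Step : Set where
  U D L : Step

_==S_ : Step → Step → Bool
U ==S U = true
D ==S D = true
L ==S L = true
_ ==S _ = false

words : ℕ → List (List Step)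
words zero    = [] ∷ []
words (suc l) = concatMap (λ w → (U ∷ w) ∷ (D ∷ w) ∷ (L ∷ w) ∷ []) (words l)

noULLU : List Step → Bool
noULLU (U ∷ L ∷ _) = false
noULLU (L ∷ U ∷ _) = false
noULLU (_ ∷ w)     = noULLU w
noULLU []          = true

heightOK : ℕ → List Step → Bool
heightOK h []            = h ≡ᵇ 0
heightOK h (U ∷ w)       = heightOK (suc h) w
heightOK zero (D ∷ w)    = false
heightOK (suc h) (D ∷ w) = heightOK h w
heightOK zero (L ∷ w)    = false
heightOK (suc h) (L ∷ w) = heightOK h w

isSkewDyck : List Step → Bool
isSkewDyck w = noULLU w ∧ heightOK 0 w

isPrefix : List Step → List Step → Bool
isPrefix []      _       = true
isPrefix (_ ∷ _) []      = false
isPrefix (a ∷ p) (b ∷ w) = (a ==S b) ∧ isPrefix p w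

-- number of occurrences of the factor p in w (p nonempty in our uses)
occurrences : List Step → List Step → ℕ
occurrences p []       = 0
occurrences p (s ∷ w)  = (if isPrefix p (s ∷ w) then 1 else 0) + occurrences p w

-- number of long ascents (maximal runs of U of length ≥ 2)
closeRun : ℕ → ℕ
closeRun r = if 2 ≤ᵇ r then 1 else 0

laGo : ℕ → List Step → ℕ
laGo r []      = closeRun r
laGo r (U ∷ w) = laGo (suc r) w
laGo r (D ∷ w) = closeRun r + laGo 0 w
laGo r (L ∷ w) = closeRun r + laGo 0 w

la : List Step → ℕ
la = laGo 0

-- k-box paths: skew Dyck path of semilength (k+2)n-1 with exactly n
-- occurrences of the factor U D^k L  (length of word = 2 * semilength)

boxFactor : ℕ → List Step
boxFactor k = U ∷ (replicate k D ++ (L ∷ []))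

isBoxPath : ℕ → ℕ → List Step → Bool
isBoxPath k n w = isSkewDyck w ∧ (occurrences (boxFactor k) w ≡ᵇ n)

boxPaths : ℕ → ℕ → List (List Step)
boxPaths k n = filterᵇ (isBoxPath k n) (words (2 * ((k + 2) * n ∸ 1)))

-- augmented m-Dyck paths of size n:
-- skew Dyck paths of the form U^{a1} D^{m-1} L D ... U^{an} D^{m-1} L D, ai ≥ 1

stripU : List Step → ℕ × List Step
stripU (U ∷ w) with stripU w
... | a , r = suc a , r
stripU w = 0 , w

dropPrefix : List Step → List Step → Maybe (List Step)
dropPrefix []      w       = just w
dropPrefix (_ ∷ _) []      = nothing
dropPrefix (a ∷ p) (b ∷ w) = if a ==S b then dropPrefix p w else nothing

augTail : ℕ → List Step
augTail m = replicate (m ∸ 1) D ++ (L ∷ D ∷ [])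

hasAugForm : ℕ → ℕ → List Step → Bool
hasAugForm m zero    []      = true
hasAugForm m zero    (_ ∷ _) = false
hasAugForm m (suc n) w with stripU w
... | zero  , r = false
... | suc _ , r with dropPrefix (augTail m) r
...   | nothing = false
...   | just r' = hasAugForm m n r'

isAugPath : ℕ → ℕ → List Step → Bool
isAugPath m n w = isSkewDyck w ∧ hasAugForm m n w

-- an augmented m-Dyck path of size n has n(m+1) U's, hence length 2n(m+1)
augPaths : ℕ → ℕ → List (List Step)
augPaths m n = filterᵇ (isAugPath m n) (words (2 * (n * (m + 1))))

countLA : ℕ → List (List Step) → ℕ
countLA j ws = length (filterᵇ (λ w → la w ≡ᵇ j) ws)

-- formal power series in t, x with integer coefficients:
-- S j n = coefficient of t^j x^n

Series : Set
Series = ℕ → ℕ → ℤ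

Gser : ℕ → Series
Gser m j n = + countLA j (augPaths m n)

Fser : ℕ → Series
Fser k j zero    = + 0
Fser k j (suc n) = + countLA j (boxPaths k (suc n))

sumTo : ℕ → (ℕ → ℤ) → ℤ
sumTo zero    f = f 0
sumTo (suc n) f = sumTo n f +ℤ f (suc n)

oneS : Series
oneS zero    zero = + 1
oneS _       _    = + 0

tS : Series
tS (suc zero) zero = + 1
tS _          _    = + 0

_⊕_ : Series → Series → Series
(f ⊕ g) j n = f j n +ℤ g j n

_⊖_ : Series → Series → Series
(f ⊖ g) j n = f j n -ℤ g j n

_⊛_ : Series → Series → Series
(f ⊛ g) j n = sumTo j (λ a → sumTo n (λ b → f a b *ℤ g (j ∸ a) (n ∸ b)))

xS : Series → Series
xS f j zero    = + 0
xS f j (suc n) = f j n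

powS : Series → ℕ → Series
powS f zero    = oneS
powS f (suc m) = f ⊛ powS f m

infixl 6 _⊕_ _⊖_
infixl 7 _⊛_

module Submission where

-- An augmented m-Dyck path is the image of a walk with steps up = (1,1) and down = (m,-m) under up ↦ U,
-- down ↦ U D^(m-1) L D, and its long ascents are the down steps directly preceded by an up step. A k-box path of
-- size n + 1 is the image of a walk from height 0 to height k followed by the box U D^k L, which adds one more long
-- ascent exactly when the walk ends with an up step. Cutting a walk to height h + 1 at its last visits to the heights
-- 0, ..., h splits it into h + 1 excursions, each followed by an up step, and a final excursion; weighting an empty
-- final excursion by t for the extra ascent, this gives G^(h+1) (G - 1 + t). Deleting the last down step of a nonempty
-- excursion leaves a walk to height m, whence G = 1 + x G^m (G - 1 + t), and the box paths give F = x G^k (G - 1 + t).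

open import Defs
open import Data.Nat using (ℕ; _≤_; _+_)
open import Data.Product using (_×_)
open import Relation.Binary.PropositionalEquality using (_≡_)

open import Data.Bool using (Bool; true; false; _∧_; if_then_else_; T)
open import Data.Nat using (zero; suc; _*_; _∸_; _≤ᵇ_; _≡ᵇ_; _<_; _≰_; z≤n; s≤s)
open import Data.Nat.Properties
open import Data.Nat.ListAction using (sum)
open import Data.Nat.ListAction.Properties using (sum-++)
open import Data.List using (List; []; _∷_; _++_; length; replicate; map; filterᵇ; concatMap)
open import Data.List.Properties using (map-++; ++-assoc; length-++; length-replicate)
open import Data.Product using (Σ; _,_; proj₁; proj₂)
open import Data.Sum using (_⊎_; inj₁; inj₂)
open import Data.Maybe using (just; nothing)
open import Data.Empty using (⊥-elim)
open import Relation.Nullary using (¬_; yes; no)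
open import Relation.Binary using (tri<; tri≈; tri>)
open import Relation.Binary.PropositionalEquality
  using (_≢_; refl; sym; trans; cong; cong₂; subst; module ≡-Reasoning)
open import Algebra.Properties.CommutativeSemigroup +-commutativeSemigroup using (interchange)
open import Data.Integer using (ℤ) renaming (+_ to pos; _+_ to _+ℤ_; _*_ to _*ℤ_; _-_ to _-ℤ_)
import Data.Integer.Properties as ℤ
open import Data.Nat.Solver using (module +-*-Solver)
open +-*-Solver using (solve; _:+_; _:*_; _:=_; con)

⟦_⟧ : Bool → ℕ
⟦ true ⟧  = 1
⟦ false ⟧ = 0

false≢true : false ≢ true
false≢true ()

T⇒≡true : ∀ {b} → T b → b ≡ true
T⇒≡true {true} _ = refl

¬T⇒≡false : ∀ {b} → ¬ T b → b ≡ false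
¬T⇒≡false {true}  ¬t = ⊥-elim (¬t _)
¬T⇒≡false {false} _  = refl

≤ᵇ-true : ∀ {m n} → m ≤ n → (m ≤ᵇ n) ≡ true
≤ᵇ-true m≤n = T⇒≡true (≤⇒≤ᵇ m≤n)

≤ᵇ-false : ∀ {m n} → m ≰ n → (m ≤ᵇ n) ≡ false
≤ᵇ-false {m} {n} m≰n = ¬T⇒≡false (λ t → m≰n (≤ᵇ⇒≤ m n t))

≡ᵇ-true : ∀ {m n} → m ≡ n → (m ≡ᵇ n) ≡ true
≡ᵇ-true {m} {n} m≡n = T⇒≡true (≡⇒≡ᵇ m n m≡n)

≡ᵇ-false : ∀ {m n} → m ≢ n → (m ≡ᵇ n) ≡ false
≡ᵇ-false {m} {n} m≢n = ¬T⇒≡false (λ t → m≢n (≡ᵇ⇒≡ m n t))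

≡ᵇ-true⁻¹ : ∀ {m n} → (m ≡ᵇ n) ≡ true → m ≡ n
≡ᵇ-true⁻¹ {m} {n} e = ≡ᵇ⇒≡ m n (subst T (sym e) _)

≤ᵇ-true⁻¹ : ∀ {m n} → (m ≤ᵇ n) ≡ true → m ≤ n
≤ᵇ-true⁻¹ {m} {n} e = ≤ᵇ⇒≤ m n (subst T (sym e) _)

≤ᵇ-+-cancelˡ : ∀ s a b → (s + a ≤ᵇ s + b) ≡ (a ≤ᵇ b)
≤ᵇ-+-cancelˡ zero          a       b = refl
≤ᵇ-+-cancelˡ (suc zero)    zero    b = refl
≤ᵇ-+-cancelˡ (suc zero)    (suc a) b = refl
≤ᵇ-+-cancelˡ (suc (suc s)) a       b = ≤ᵇ-+-cancelˡ (suc s) a b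

≡ᵇ-+-cancelˡ : ∀ s a b → (s + a ≡ᵇ s + b) ≡ (a ≡ᵇ b)
≡ᵇ-+-cancelˡ zero    a b = refl
≡ᵇ-+-cancelˡ (suc s) a b = ≡ᵇ-+-cancelˡ s a b

≡ᵇ-cong-⇔ : ∀ {m n m′ n′} → (m ≡ n → m′ ≡ n′) → (m′ ≡ n′ → m ≡ n) → (m ≡ᵇ n) ≡ (m′ ≡ᵇ n′)
≡ᵇ-cong-⇔ {m} {n} to from with m ≟ n
... | yes m≡n = trans (≡ᵇ-true m≡n) (sym (≡ᵇ-true (to m≡n)))
... | no  m≢n = trans (≡ᵇ-false m≢n) (sym (≡ᵇ-false (λ e → m≢n (from e))))

∧-true⁻¹ : ∀ {a b} → (a ∧ b) ≡ true → (a ≡ true) × (b ≡ true)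
∧-true⁻¹ {true} {true} _ = refl , refl

m+m≡n+n⇒m≡n : ∀ m n → m + m ≡ n + n → m ≡ n
m+m≡n+n⇒m≡n zero    zero    _ = refl
m+m≡n+n⇒m≡n (suc m) (suc n) e =
  cong suc (m+m≡n+n⇒m≡n m n (suc-injective (trans (sym (+-suc m m)) (trans (suc-injective e) (+-suc n n)))))

j∸a≡1+j∸[1+a] : ∀ j a → a < j → j ∸ a ≡ suc (j ∸ suc a)
j∸a≡1+j∸[1+a] (suc j) zero    _         = refl
j∸a≡1+j∸[1+a] (suc j) (suc a) (s≤s a<j) = j∸a≡1+j∸[1+a] j a a<j

sum≤ : ℕ → (ℕ → ℕ) → ℕ
sum≤ zero    f = f 0
sum≤ (suc n) f = sum≤ n f + f (suc n)

sum≤-cong : ∀ n {f g : ℕ → ℕ} → (∀ i → i ≤ n → f i ≡ g i) → sum≤ n f ≡ sum≤ n g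
sum≤-cong zero    f≗g = f≗g 0 z≤n
sum≤-cong (suc n) f≗g = cong₂ _+_ (sum≤-cong n (λ i i≤n → f≗g i (m≤n⇒m≤1+n i≤n))) (f≗g (suc n) ≤-refl)

sum≤-+ : ∀ n (f g : ℕ → ℕ) → sum≤ n (λ i → f i + g i) ≡ sum≤ n f + sum≤ n g
sum≤-+ zero    f g = refl
sum≤-+ (suc n) f g = trans (cong (_+ (f (suc n) + g (suc n))) (sum≤-+ n f g))
                           (interchange (sum≤ n f) (sum≤ n g) (f (suc n)) (g (suc n)))

sum≤-*ˡ : ∀ n c (f : ℕ → ℕ) → sum≤ n (λ i → c * f i) ≡ c * sum≤ n f
sum≤-*ˡ zero    c f = refl
sum≤-*ˡ (suc n) c f = trans (cong (_+ c * f (suc n)) (sum≤-*ˡ n c f)) (sym (*-distribˡ-+ c (sum≤ n f) (f (suc n))))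

sum≤-zero : ∀ n {f : ℕ → ℕ} → (∀ i → i ≤ n → f i ≡ 0) → sum≤ n f ≡ 0
sum≤-zero n {f} f≗0 = trans (sum≤-cong n f≗0) (zeros n)
  where
  zeros : ∀ n → sum≤ n (λ _ → 0) ≡ 0
  zeros zero    = refl
  zeros (suc n) = cong (_+ 0) (zeros n)

sum≤-suc : ∀ n (f : ℕ → ℕ) → sum≤ (suc n) f ≡ f 0 + sum≤ n (λ i → f (suc i))
sum≤-suc zero    f = refl
sum≤-suc (suc n) f = trans (cong (_+ f (suc (suc n))) (sum≤-suc n f)) (+-assoc (f 0) _ _)

sum≤-single : ∀ n p {f : ℕ → ℕ} → p ≤ n → (∀ i → i ≤ n → i ≢ p → f i ≡ 0) → sum≤ n f ≡ f p
sum≤-single zero    zero z≤n _ = refl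
sum≤-single (suc n) p {f} p≤1+n f≗0 with p ≟ suc n
... | yes refl = cong (_+ f (suc n)) (sum≤-zero n (λ i i≤n → f≗0 i (m≤n⇒m≤1+n i≤n) (<⇒≢ (s≤s i≤n))))
... | no  p≢1+n =
  trans (cong₂ _+_ (sum≤-single n p (≤-pred (≤∧≢⇒< p≤1+n p≢1+n)) (λ i i≤n → f≗0 i (m≤n⇒m≤1+n i≤n)))
                   (f≗0 (suc n) ≤-refl (λ e → p≢1+n (sym e))))
        (+-identityʳ _)

sum≤-split : ∀ a r (f : ℕ → ℕ) → sum≤ (a + suc r) f ≡ sum≤ a f + sum≤ r (λ i → f (a + suc i))
sum≤-split a zero    f rewrite +-suc a 0 | +-identityʳ a = refl
sum≤-split a (suc r) f =
  trans (cong (λ z → sum≤ z f) (+-suc a (suc r)))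
  (trans (cong (_+ f (suc (a + suc r))) (sum≤-split a r f))
  (trans (+-assoc (sum≤ a f) _ _)
         (cong (λ z → sum≤ a f + (sum≤ r (λ i → f (a + suc i)) + f z)) (sym (+-suc a (suc r))))))

sum≤-vanishingTail : ∀ a e (f : ℕ → ℕ) → (∀ i → i < e → f (a + suc i) ≡ 0) → sum≤ (a + e) f ≡ sum≤ a f
sum≤-vanishingTail a zero    f _     = cong (λ z → sum≤ z f) (+-identityʳ a)
sum≤-vanishingTail a (suc e) f tail0 =
  trans (sum≤-split a e f) (trans (cong (sum≤ a f +_) (sum≤-zero e (λ i i≤e → tail0 i (s≤s i≤e)))) (+-identityʳ (sum≤ a f)))

⟦+≡ᵇ⟧-convolution : ∀ x y j → ⟦ x + y ≡ᵇ j ⟧ ≡ sum≤ j (λ a → ⟦ x ≡ᵇ a ⟧ * ⟦ y ≡ᵇ j ∸ a ⟧)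
⟦+≡ᵇ⟧-convolution x y j with x ≤? j
... | yes x≤j = sym (begin
    sum≤ j (λ a → ⟦ x ≡ᵇ a ⟧ * ⟦ y ≡ᵇ j ∸ a ⟧)
  ≡⟨ sum≤-single j x x≤j (λ a _ a≢x → cong (λ b → ⟦ b ⟧ * ⟦ y ≡ᵇ j ∸ a ⟧) (≡ᵇ-false (λ e → a≢x (sym e)))) ⟩
    ⟦ x ≡ᵇ x ⟧ * ⟦ y ≡ᵇ j ∸ x ⟧
  ≡⟨ cong (λ b → ⟦ b ⟧ * ⟦ y ≡ᵇ j ∸ x ⟧) (≡ᵇ-true {x} refl) ⟩
    ⟦ y ≡ᵇ j ∸ x ⟧ + 0
  ≡⟨ +-identityʳ _ ⟩
    ⟦ y ≡ᵇ j ∸ x ⟧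
  ≡⟨ cong ⟦_⟧ (≡ᵇ-cong-⇔ (λ e → trans (cong (x +_) e) (m+[n∸m]≡n x≤j))
                          (λ e → trans (sym (m+n∸m≡n x y)) (cong (_∸ x) e))) ⟩
    ⟦ x + y ≡ᵇ j ⟧
  ∎)
  where open ≡-Reasoning
... | no x≰j = trans (cong ⟦_⟧ (≡ᵇ-false (λ e → x≰j (subst (x ≤_) e (m≤m+n x y)))))
                     (sym (sum≤-zero j (λ a a≤j → cong (λ b → ⟦ b ⟧ * ⟦ y ≡ᵇ j ∸ a ⟧)
                                                     (≡ᵇ-false (λ e → x≰j (subst (_≤ j) (sym e) a≤j))))))

sum≤-toℤ : ∀ n (f : ℕ → ℕ) → pos (sum≤ n f) ≡ sumTo n (λ i → pos (f i))
sum≤-toℤ zero    f = refl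
sum≤-toℤ (suc n) f = trans (ℤ.pos-+ (sum≤ n f) (f (suc n))) (cong (_+ℤ pos (f (suc n))) (sum≤-toℤ n f))

data Move : Set where
  up down : Move

sumMoveWords : ℕ → (List Move → ℕ) → ℕ
sumMoveWords zero    f = f []
sumMoveWords (suc ℓ) f = sumMoveWords ℓ (λ w → f (up ∷ w)) + sumMoveWords ℓ (λ w → f (down ∷ w))

sumMoveWords-cong : ∀ ℓ {f g : List Move → ℕ} → (∀ w → length w ≡ ℓ → f w ≡ g w) → sumMoveWords ℓ f ≡ sumMoveWords ℓ g
sumMoveWords-cong zero    f≗g = f≗g [] refl
sumMoveWords-cong (suc ℓ) f≗g = cong₂ _+_ (sumMoveWords-cong ℓ (λ w e → f≗g (up ∷ w) (cong suc e)))
                                          (sumMoveWords-cong ℓ (λ w e → f≗g (down ∷ w) (cong suc e)))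

sumMoveWords-zero : ∀ ℓ {f : List Move → ℕ} → (∀ w → length w ≡ ℓ → f w ≡ 0) → sumMoveWords ℓ f ≡ 0
sumMoveWords-zero zero    f≗0 = f≗0 [] refl
sumMoveWords-zero (suc ℓ) f≗0 = cong₂ _+_ (sumMoveWords-zero ℓ (λ w e → f≗0 (up ∷ w) (cong suc e)))
                                          (sumMoveWords-zero ℓ (λ w e → f≗0 (down ∷ w) (cong suc e)))

sumMoveWords-+ : ∀ ℓ (f g : List Move → ℕ) → sumMoveWords ℓ (λ w → f w + g w) ≡ sumMoveWords ℓ f + sumMoveWords ℓ g
sumMoveWords-+ zero    f g = refl
sumMoveWords-+ (suc ℓ) f g =
  trans (cong₂ _+_ (sumMoveWords-+ ℓ (λ w → f (up ∷ w)) (λ w → g (up ∷ w)))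
                   (sumMoveWords-+ ℓ (λ w → f (down ∷ w)) (λ w → g (down ∷ w))))
        (interchange (sumMoveWords ℓ (λ w → f (up ∷ w))) (sumMoveWords ℓ (λ w → g (up ∷ w)))
                     (sumMoveWords ℓ (λ w → f (down ∷ w))) (sumMoveWords ℓ (λ w → g (down ∷ w))))

sumMoveWords-*ˡ : ∀ ℓ c (f : List Move → ℕ) → sumMoveWords ℓ (λ w → c * f w) ≡ c * sumMoveWords ℓ f
sumMoveWords-*ˡ zero    c f = refl
sumMoveWords-*ˡ (suc ℓ) c f = trans (cong₂ _+_ (sumMoveWords-*ˡ ℓ c (λ w → f (up ∷ w))) (sumMoveWords-*ˡ ℓ c (λ w → f (down ∷ w))))
                                    (sym (*-distribˡ-+ c (sumMoveWords ℓ (λ w → f (up ∷ w))) (sumMoveWords ℓ (λ w → f (down ∷ w)))))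

sumMoveWords-sum≤ : ∀ ℓ n (F : ℕ → List Move → ℕ) →
                    sumMoveWords ℓ (λ w → sum≤ n (λ i → F i w)) ≡ sum≤ n (λ i → sumMoveWords ℓ (F i))
sumMoveWords-sum≤ ℓ zero    F = refl
sumMoveWords-sum≤ ℓ (suc n) F = trans (sumMoveWords-+ ℓ (λ w → sum≤ n (λ i → F i w)) (F (suc n)))
                                      (cong (_+ sumMoveWords ℓ (F (suc n))) (sumMoveWords-sum≤ ℓ n F))

sumMoveWords-snoc : ∀ ℓ (f : List Move → ℕ) →
  sumMoveWords (suc ℓ) f ≡ sumMoveWords ℓ (λ w → f (w ++ up ∷ [])) + sumMoveWords ℓ (λ w → f (w ++ down ∷ []))
sumMoveWords-snoc zero    f = refl
sumMoveWords-snoc (suc ℓ) f = trans (cong₂ _+_ (sumMoveWords-snoc ℓ (λ w → f (up ∷ w))) (sumMoveWords-snoc ℓ (λ w → f (down ∷ w))))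
                                    (interchange (sumMoveWords ℓ (λ w → f (up ∷ w ++ up ∷ [])))
                                                 (sumMoveWords ℓ (λ w → f (up ∷ w ++ down ∷ [])))
                                                 (sumMoveWords ℓ (λ w → f (down ∷ w ++ up ∷ [])))
                                                 (sumMoveWords ℓ (λ w → f (down ∷ w ++ down ∷ []))))

_==ᵐ_ : List Move → List Move → Bool
[]         ==ᵐ []         = true
(up ∷ v)   ==ᵐ (up ∷ w)   = v ==ᵐ w
(down ∷ v) ==ᵐ (down ∷ w) = v ==ᵐ w
_          ==ᵐ _          = false

sumMoveWords-single : ∀ v (g : List Move → ℕ) → sumMoveWords (length v) (λ w → ⟦ v ==ᵐ w ⟧ * g w) ≡ g v
sumMoveWords-single []         g = +-identityʳ (g [])
sumMoveWords-single (up ∷ v)   g = trans (cong₂ _+_ (sumMoveWords-single v (λ w → g (up ∷ w))) (sumMoveWords-zero (length v) (λ _ _ → refl)))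
                                         (+-identityʳ _)
sumMoveWords-single (down ∷ v) g = trans (cong (_+ sumMoveWords (length v) (λ w → ⟦ v ==ᵐ w ⟧ * g (down ∷ w)))
                                               (sumMoveWords-zero (length v) (λ _ _ → refl)))
                                         (sumMoveWords-single v (λ w → g (down ∷ w)))

-- sumUpSplits G w = Σ { G P R ∣ w ≡ P ++ up ∷ R }
sumUpSplits : (List Move → List Move → ℕ) → List Move → ℕ
sumUpSplits G []         = 0
sumUpSplits G (up ∷ w)   = G [] w + sumUpSplits (λ P R → G (up ∷ P) R) w
sumUpSplits G (down ∷ w) = sumUpSplits (λ P R → G (down ∷ P) R) w

sumUpSplits-cong : ∀ w {G H : List Move → List Move → ℕ} → (∀ P R → G P R ≡ H P R) → sumUpSplits G w ≡ sumUpSplits H w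
sumUpSplits-cong []         G≗H = refl
sumUpSplits-cong (up ∷ w)   G≗H = cong₂ _+_ (G≗H [] w) (sumUpSplits-cong w (λ P R → G≗H (up ∷ P) R))
sumUpSplits-cong (down ∷ w) G≗H = sumUpSplits-cong w (λ P R → G≗H (down ∷ P) R)

sumUpSplits-+ : ∀ w (G H : List Move → List Move → ℕ) →
                sumUpSplits (λ P R → G P R + H P R) w ≡ sumUpSplits G w + sumUpSplits H w
sumUpSplits-+ []         G H = refl
sumUpSplits-+ (up ∷ w)   G H = trans (cong (G [] w + H [] w +_) (sumUpSplits-+ w (λ P R → G (up ∷ P) R) (λ P R → H (up ∷ P) R)))
                                     (interchange (G [] w) (H [] w) (sumUpSplits (λ P R → G (up ∷ P) R) w)
                                                  (sumUpSplits (λ P R → H (up ∷ P) R) w))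
sumUpSplits-+ (down ∷ w) G H = sumUpSplits-+ w (λ P R → G (down ∷ P) R) (λ P R → H (down ∷ P) R)

sumUpSplits-sum≤ : ∀ w n (G : ℕ → List Move → List Move → ℕ) →
                   sumUpSplits (λ P R → sum≤ n (λ i → G i P R)) w ≡ sum≤ n (λ i → sumUpSplits (G i) w)
sumUpSplits-sum≤ w zero    G = refl
sumUpSplits-sum≤ w (suc n) G = trans (sumUpSplits-+ w (λ P R → sum≤ n (λ i → G i P R)) (G (suc n)))
                                     (cong (_+ sumUpSplits (G (suc n)) w) (sumUpSplits-sum≤ w n G))

sumUpSplits-zero : ∀ w {G : List Move → List Move → ℕ} → (∀ P R → G P R ≡ 0) → sumUpSplits G w ≡ 0
sumUpSplits-zero []         G≗0 = refl
sumUpSplits-zero (up ∷ w)   G≗0 = cong₂ _+_ (G≗0 [] w) (sumUpSplits-zero w (λ P R → G≗0 (up ∷ P) R))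
sumUpSplits-zero (down ∷ w) G≗0 = sumUpSplits-zero w (λ P R → G≗0 (down ∷ P) R)

sumMoveWords-sumUpSplits : ∀ ℓ (g h : List Move → ℕ) →
  sumMoveWords (suc ℓ) (sumUpSplits (λ P R → g P * h R)) ≡ sum≤ ℓ (λ i → sumMoveWords i g * sumMoveWords (ℓ ∸ i) h)
sumMoveWords-sumUpSplits zero    g h = trans (+-identityʳ _) (+-identityʳ _)
sumMoveWords-sumUpSplits (suc ℓ) g h =
  begin
    sumMoveWords (suc ℓ) (λ w → g [] * h w + sumUpSplits (λ P R → g (up ∷ P) * h R) w) + Sᵈ
  ≡⟨ cong (_+ Sᵈ) (sumMoveWords-+ (suc ℓ) (λ w → g [] * h w) (sumUpSplits (λ P R → g (up ∷ P) * h R))) ⟩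
    (sumMoveWords (suc ℓ) (λ w → g [] * h w) + Sᵘ) + Sᵈ
  ≡⟨ +-assoc (sumMoveWords (suc ℓ) (λ w → g [] * h w)) Sᵘ Sᵈ ⟩
    sumMoveWords (suc ℓ) (λ w → g [] * h w) + (Sᵘ + Sᵈ)
  ≡⟨ cong₂ _+_ (sumMoveWords-*ˡ (suc ℓ) (g []) h)
               (cong₂ _+_ (sumMoveWords-sumUpSplits ℓ (λ P → g (up ∷ P)) h) (sumMoveWords-sumUpSplits ℓ (λ P → g (down ∷ P)) h)) ⟩
    g [] * sumMoveWords (suc ℓ) h + (sum≤ ℓ (λ i → sumMoveWords i (λ P → g (up ∷ P)) * sumMoveWords (ℓ ∸ i) h)
                                   + sum≤ ℓ (λ i → sumMoveWords i (λ P → g (down ∷ P)) * sumMoveWords (ℓ ∸ i) h))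
  ≡⟨ cong (g [] * sumMoveWords (suc ℓ) h +_)
          (sym (trans (sum≤-cong ℓ (λ i _ → *-distribʳ-+ (sumMoveWords (ℓ ∸ i) h)
                                                 (sumMoveWords i (λ P → g (up ∷ P))) (sumMoveWords i (λ P → g (down ∷ P)))))
                      (sum≤-+ ℓ (λ i → sumMoveWords i (λ P → g (up ∷ P)) * sumMoveWords (ℓ ∸ i) h)
                                (λ i → sumMoveWords i (λ P → g (down ∷ P)) * sumMoveWords (ℓ ∸ i) h)))) ⟩
    g [] * sumMoveWords (suc ℓ) h + sum≤ ℓ (λ i → sumMoveWords (suc i) g * sumMoveWords (suc ℓ ∸ suc i) h)
  ≡⟨ sym (sum≤-suc ℓ (λ i → sumMoveWords i g * sumMoveWords (suc ℓ ∸ i) h)) ⟩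
    sum≤ (suc ℓ) (λ i → sumMoveWords i g * sumMoveWords (suc ℓ ∸ i) h)
  ∎
  where
  open ≡-Reasoning
  Sᵘ = sumMoveWords (suc ℓ) (sumUpSplits (λ P R → g (up ∷ P) * h R))
  Sᵈ = sumMoveWords (suc ℓ) (sumUpSplits (λ P R → g (down ∷ P) * h R))

-- peaks b w counts the down steps of w directly preceded by an up step, b telling whether w is preceded by one.
peaks : Bool → List Move → ℕ
peaks b []         = 0
peaks b (up ∷ w)   = peaks true w
peaks b (down ∷ w) = ⟦ b ⟧ + peaks false w

endsUp : Bool → List Move → Bool
endsUp b []         = b
endsUp b (up ∷ w)   = endsUp true w
endsUp b (down ∷ w) = endsUp false w

peaks-++ : ∀ b P Q → peaks b (P ++ Q) ≡ peaks b P + peaks (endsUp b P) Q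
peaks-++ b []         Q = refl
peaks-++ b (up ∷ P)   Q = peaks-++ true P Q
peaks-++ b (down ∷ P) Q = trans (cong (⟦ b ⟧ +_) (peaks-++ false P Q)) (sym (+-assoc ⟦ b ⟧ _ _))

endsUp-++ : ∀ b P Q → endsUp b (P ++ Q) ≡ endsUp (endsUp b P) Q
endsUp-++ b []         Q = refl
endsUp-++ b (up ∷ P)   Q = endsUp-++ true P Q
endsUp-++ b (down ∷ P) Q = endsUp-++ false P Q

-- With the flag set, a final up step counts as one more peak; the empty word counts as ending with an up step.
weight : Bool → List Move → ℕ
weight false v = peaks false v
weight true  v = peaks false v + ⟦ endsUp true v ⟧

downs : List Move → ℕ
downs []         = 0
downs (up ∷ w)   = downs w
downs (down ∷ w) = suc (downs w)

_≐_ : Series → Series → Set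
F ≐ G = ∀ j n → F j n ≡ G j n

sumTo-cong : ∀ n {f g : ℕ → ℤ} → (∀ i → i ≤ n → f i ≡ g i) → sumTo n f ≡ sumTo n g
sumTo-cong zero    f≗g = f≗g 0 z≤n
sumTo-cong (suc n) f≗g = cong₂ _+ℤ_ (sumTo-cong n (λ i i≤n → f≗g i (m≤n⇒m≤1+n i≤n))) (f≗g (suc n) ≤-refl)

sumTo-zero : ∀ n {f : ℕ → ℤ} → (∀ i → i ≤ n → f i ≡ pos 0) → sumTo n f ≡ pos 0
sumTo-zero zero    f≗0 = f≗0 0 z≤n
sumTo-zero (suc n) f≗0 = cong₂ _+ℤ_ (sumTo-zero n (λ i i≤n → f≗0 i (m≤n⇒m≤1+n i≤n))) (f≗0 (suc n) ≤-refl)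

sumTo-last : ∀ n {f : ℕ → ℤ} → (∀ i → i < n → f i ≡ pos 0) → sumTo n f ≡ f n
sumTo-last zero    f≗0 = refl
sumTo-last (suc n) {f} f≗0 = trans (cong (_+ℤ f (suc n)) (sumTo-zero n (λ i i≤n → f≗0 i (s≤s i≤n)))) (ℤ.+-identityˡ (f (suc n)))

⊛-cong : ∀ {F F′ G G′} → F ≐ F′ → G ≐ G′ → (F ⊛ G) ≐ (F′ ⊛ G′)
⊛-cong F≐F′ G≐G′ j n = sumTo-cong j (λ a _ → sumTo-cong n (λ b _ → cong₂ _*ℤ_ (F≐F′ a b) (G≐G′ (j ∸ a) (n ∸ b))))

powS-cong : ∀ {F F′} → F ≐ F′ → ∀ k → powS F k ≐ powS F′ k
powS-cong F≐F′ zero    j n = refl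
powS-cong F≐F′ (suc k) = ⊛-cong F≐F′ (powS-cong F≐F′ k)

xS-cong : ∀ {F F′} → F ≐ F′ → xS F ≐ xS F′
xS-cong F≐F′ j zero    = refl
xS-cong F≐F′ j (suc n) = F≐F′ j n

powS-⊛-⊖oneS⊕tS-cong : ∀ {F F′} → F ≐ F′ → ∀ h → (powS F h ⊛ (F ⊖ oneS ⊕ tS)) ≐ (powS F′ h ⊛ (F′ ⊖ oneS ⊕ tS))
powS-⊛-⊖oneS⊕tS-cong F≐F′ h = ⊛-cong (powS-cong F≐F′ h) (λ j n → cong (λ z → z -ℤ oneS j n +ℤ tS j n) (F≐F′ j n))

⊛-identityʳ : ∀ F → (F ⊛ oneS) ≐ F
⊛-identityʳ F j n =
  trans (sumTo-last j (λ a a<j → sumTo-zero n (λ b _ → trans (cong (F a b *ℤ_) (oneS-off (j∸a≡1+j∸[1+a] j a a<j))) (ℤ.*-zeroʳ (F a b)))))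
  (trans (cong (λ z → sumTo n (λ b → F j b *ℤ oneS z (n ∸ b))) (n∸n≡0 j))
  (trans (sumTo-last n (λ b b<n → trans (cong (λ z → F j b *ℤ oneS 0 z) (j∸a≡1+j∸[1+a] n b b<n)) (ℤ.*-zeroʳ (F j b))))
  (trans (cong (λ z → F j n *ℤ oneS 0 z) (n∸n≡0 n)) (ℤ.*-identityʳ (F j n)))))
  where
  oneS-off : ∀ {a b c} → a ≡ suc c → oneS a b ≡ pos 0
  oneS-off refl = refl

-- Walks with steps (1,1) and (m,-m), where m = suc k

module Walks (k : ℕ) where

  m K : ℕ
  m = suc k
  K = suc m

  -- isWalk fl x w E: the walk w started at height x never goes below fl and ends at height E.
  isWalk : ℕ → ℕ → List Move → ℕ → Bool
  isWalk fl x []         E = x ≡ᵇ E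
  isWalk fl x (up ∷ w)   E = isWalk fl (suc x) w E
  isWalk fl x (down ∷ w) E = if fl + m ≤ᵇ x then isWalk fl (x ∸ m) w E else false

  isWalk-shift : ∀ s x w e → isWalk s (s + x) w (s + e) ≡ isWalk 0 x w e
  isWalk-shift s x []         e = ≡ᵇ-+-cancelˡ s x e
  isWalk-shift s x (up ∷ w)   e = trans (cong (λ y → isWalk s y w (s + e)) (sym (+-suc s x))) (isWalk-shift s (suc x) w e)
  isWalk-shift s x (down ∷ w) e rewrite ≤ᵇ-+-cancelˡ s m x with m ≤ᵇ x in m≤x
  ... | true  = trans (cong (λ y → isWalk s y w (s + e)) (+-∸-assoc s (≤ᵇ-true⁻¹ m≤x))) (isWalk-shift s (x ∸ m) w e)
  ... | false = refl

  isWalk-floor-up : ∀ c e x w φ →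
    ⟦ x ≡ᵇ c ⟧ * ⟦ isWalk 0 0 w e ⟧ * φ + ⟦ suc c ≤ᵇ x ⟧ * ⟦ isWalk (suc c) (suc x) w (suc c + e) ⟧ * φ
      ≡ ⟦ suc c ≤ᵇ suc x ⟧ * ⟦ isWalk (suc c) (suc x) w (suc c + e) ⟧ * φ
  isWalk-floor-up c e x w φ with <-cmp x c
  ... | tri< x<c _ _ rewrite ≡ᵇ-false {x} {c} (<⇒≢ x<c) | ≤ᵇ-false {suc c} {x} (λ p → <⇒≱ x<c (≤-trans (n≤1+n c) p))
                           | ≤ᵇ-false {suc c} {suc x} (λ p → <⇒≱ x<c (≤-pred p)) = refl
  ... | tri≈ _ refl _ rewrite ≡ᵇ-true {x} {x} refl | ≤ᵇ-false {suc x} {x} (n≮n x) | ≤ᵇ-true {suc x} {suc x} ≤-refl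
                            | sym (isWalk-shift (suc x) 0 w e) | +-identityʳ x = +-identityʳ _
  ... | tri> _ _ c<x rewrite ≡ᵇ-false {x} {c} (λ p → <⇒≢ c<x (sym p)) | ≤ᵇ-true {suc c} {x} c<x
                           | ≤ᵇ-true {suc c} {suc x} (s≤s (<⇒≤ c<x)) = refl

  isWalk-floor-down : ∀ c E x w φ → m ≤ x →
    ⟦ suc c ≤ᵇ x ∸ m ⟧ * ⟦ isWalk (suc c) (x ∸ m) w E ⟧ * φ ≡ ⟦ suc c ≤ᵇ x ⟧ * ⟦ isWalk (suc c) x (down ∷ w) E ⟧ * φ
  isWalk-floor-down c E x w φ m≤x with suc c + m ≤ᵇ x in c+m≤x
  ... | true rewrite ≤ᵇ-true {suc c} {x ∸ m} (m+n≤o⇒m≤o∸n (suc c) (≤ᵇ-true⁻¹ {suc c + m} {x} c+m≤x))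
                   | ≤ᵇ-true {suc c} {x} (≤-trans (m≤m+n (suc c) m) (≤ᵇ-true⁻¹ {suc c + m} {x} c+m≤x)) = refl
  ... | false rewrite ≤ᵇ-false {suc c} {x ∸ m} (λ p → subst T c+m≤x (≤⇒≤ᵇ (m≤o∸n⇒m+n≤o (suc c) m≤x p)))
                    | *-zeroʳ ⟦ suc c ≤ᵇ x ⟧ = refl

  -- Cut a walk to height c + 1 + e after its last visit to height c, if there is one.
  isWalk-lastVisit : ∀ c e w x (Φ : List Move → ℕ) →
    ⟦ isWalk 0 x w (suc c + e) ⟧ * Φ w ≡
      sumUpSplits (λ P R → ⟦ isWalk 0 x P c ⟧ * ⟦ isWalk 0 0 R e ⟧ * Φ (P ++ up ∷ R)) w
      + ⟦ suc c ≤ᵇ x ⟧ * ⟦ isWalk (suc c) x w (suc c + e) ⟧ * Φ w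
  isWalk-lastVisit c e [] x Φ with x ≡ᵇ suc c + e in x≡E
  ... | true rewrite ≤ᵇ-true {suc c} {x} (subst (suc c ≤_) (sym (≡ᵇ-true⁻¹ x≡E)) (m≤m+n (suc c) e)) = refl
  ... | false rewrite *-zeroʳ ⟦ suc c ≤ᵇ x ⟧ = refl
  isWalk-lastVisit c e (up ∷ w) x Φ =
    begin
      ⟦ isWalk 0 (suc x) w (suc c + e) ⟧ * Φ (up ∷ w)
    ≡⟨ isWalk-lastVisit c e w (suc x) (λ w → Φ (up ∷ w)) ⟩
      S + ⟦ suc c ≤ᵇ suc x ⟧ * ⟦ isWalk (suc c) (suc x) w (suc c + e) ⟧ * Φ (up ∷ w)
    ≡⟨ cong (S +_) (sym (isWalk-floor-up c e x w (Φ (up ∷ w)))) ⟩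
      S + (A + B)
    ≡⟨ sym (+-assoc S A B) ⟩
      (S + A) + B
    ≡⟨ cong (_+ B) (+-comm S A) ⟩
      (A + S) + B
    ∎
    where
    open ≡-Reasoning
    S = sumUpSplits (λ P R → ⟦ isWalk 0 (suc x) P c ⟧ * ⟦ isWalk 0 0 R e ⟧ * Φ (up ∷ (P ++ up ∷ R))) w
    A = ⟦ x ≡ᵇ c ⟧ * ⟦ isWalk 0 0 w e ⟧ * Φ (up ∷ w)
    B = ⟦ suc c ≤ᵇ x ⟧ * ⟦ isWalk (suc c) (suc x) w (suc c + e) ⟧ * Φ (up ∷ w)
  isWalk-lastVisit c e (down ∷ w) x Φ with m ≤ᵇ x in m≤x
  ... | false = sym (cong₂ _+_ (sumUpSplits-zero w (λ P R → refl)) stuck)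
    where
    stuck : ⟦ suc c ≤ᵇ x ⟧ * ⟦ if suc c + m ≤ᵇ x then isWalk (suc c) (x ∸ m) w (suc c + e) else false ⟧ * Φ (down ∷ w) ≡ 0
    stuck rewrite ≤ᵇ-false {suc c + m} {x} (λ p → subst T m≤x (≤⇒≤ᵇ (m+n≤o⇒n≤o (suc c) p))) | *-zeroʳ ⟦ suc c ≤ᵇ x ⟧ = refl
  ... | true = trans (isWalk-lastVisit c e w (x ∸ m) (λ w → Φ (down ∷ w)))
                     (cong₂ _+_ (sumUpSplits-cong w (λ P R → refl))
                                (isWalk-floor-down c (suc c + e) x w (Φ (down ∷ w)) (≤ᵇ-true⁻¹ {m} {x} m≤x)))

  isWalk-length : ∀ x v E → isWalk 0 x v E ≡ true → x + length v ≡ E + K * downs v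
  isWalk-length x []       E walk = trans (+-identityʳ x) (trans (≡ᵇ-true⁻¹ walk) (sym (trans (cong (E +_) (*-zeroʳ K)) (+-identityʳ E))))
  isWalk-length x (up ∷ v) E walk = trans (+-suc x (length v)) (isWalk-length (suc x) v E walk)
  isWalk-length x (down ∷ v) E walk with m ≤ᵇ x in m≤x
  ... | true = begin
      x + suc (length v)                ≡⟨ cong (_+ suc (length v)) (sym (m∸n+n≡m (≤ᵇ-true⁻¹ m≤x))) ⟩
      (x ∸ m + m) + suc (length v)      ≡⟨ solve 3 (λ y l s → (y :+ s) :+ (con 1 :+ l) := (y :+ l) :+ (con 1 :+ s)) refl (x ∸ m) (length v) m ⟩
      (x ∸ m + length v) + K            ≡⟨ cong (_+ K) (isWalk-length (x ∸ m) v E walk) ⟩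
      (E + K * downs v) + K             ≡⟨ solve 3 (λ E c k → (E :+ k :* c) :+ k := E :+ k :* (con 1 :+ c)) refl E (downs v) K ⟩
      E + K * suc (downs v)             ∎
    where open ≡-Reasoning
  ... | false = ⊥-elim (false≢true walk)

  isWalk-downs : ∀ v E n → isWalk 0 0 v E ≡ true → length v ≡ K * n + E → downs v ≡ n
  isWalk-downs v E n walk len =
    *-cancelˡ-≡ (downs v) n K (+-cancelʳ-≡ E _ _ (trans (+-comm (K * downs v) E) (trans (sym (isWalk-length 0 v E walk)) len)))

  sumMoveWords-isWalk-offProgression : ∀ c ℓ (F : List Move → ℕ) → (∀ b → ℓ ≢ K * b + c) →
                                       sumMoveWords ℓ (λ v → ⟦ isWalk 0 0 v c ⟧ * F v) ≡ 0
  sumMoveWords-isWalk-offProgression c ℓ F off = sumMoveWords-zero ℓ vanish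
    where
    vanish : ∀ v → length v ≡ ℓ → ⟦ isWalk 0 0 v c ⟧ * F v ≡ 0
    vanish v len with isWalk 0 0 v c in walk
    ... | false = refl
    ... | true  = ⊥-elim (off (downs v) (trans (sym len) (trans (isWalk-length 0 v c walk) (+-comm c _))))

  sumMoveWords-isWalk-short : ∀ e ℓ (F : List Move → ℕ) → ℓ < e → sumMoveWords ℓ (λ v → ⟦ isWalk 0 0 v e ⟧ * F v) ≡ 0
  sumMoveWords-isWalk-short e ℓ F ℓ<e = sumMoveWords-zero ℓ vanish
    where
    vanish : ∀ v → length v ≡ ℓ → ⟦ isWalk 0 0 v e ⟧ * F v ≡ 0
    vanish v len with isWalk 0 0 v e in walk
    ... | false = refl
    ... | true  = ⊥-elim (<⇒≱ ℓ<e (subst (e ≤_) (trans (sym (isWalk-length 0 v e walk)) len) (m≤m+n e _)))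

  sum≤-progression : ∀ c n (f : ℕ → ℕ) → (∀ ℓ → (∀ b → ℓ ≢ K * b + c) → f ℓ ≡ 0) →
                     sum≤ (K * n + c) f ≡ sum≤ n (λ b → f (K * b + c))
  sum≤-progression c zero f off rewrite *-zeroʳ K =
    sum≤-single c c ≤-refl (λ ℓ ℓ≤c ℓ≢c → off ℓ (λ b e → ℓ≢c (≤-antisym ℓ≤c (subst (c ≤_) (sym e) (m≤n+m c (K * b))))))
  sum≤-progression c (suc n) f off =
    begin
      sum≤ (K * suc n + c) f
    ≡⟨ cong (λ z → sum≤ z f) next ⟩
      sum≤ ((K * n + c) + suc m) f
    ≡⟨ sum≤-split (K * n + c) m f ⟩
      sum≤ (K * n + c) f + sum≤ m (λ i → f ((K * n + c) + suc i))
    ≡⟨ cong₂ _+_ (sum≤-progression c n f off) (sum≤-single m m ≤-refl between) ⟩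
      sum≤ n (λ b → f (K * b + c)) + f ((K * n + c) + suc m)
    ≡⟨ cong (λ z → sum≤ n (λ b → f (K * b + c)) + f z) (sym next) ⟩
      sum≤ n (λ b → f (K * b + c)) + f (K * suc n + c)
    ∎
    where
    open ≡-Reasoning
    next : K * suc n + c ≡ (K * n + c) + suc m
    next = solve 3 (λ k n c → k :* (con 1 :+ n) :+ c := (k :* n :+ c) :+ k) refl K n c
    between : ∀ i → i ≤ m → i ≢ m → f ((K * n + c) + suc i) ≡ 0
    between i i≤m i≢m = off _ (λ b e → notMultiple b (+-cancelʳ-≡ c _ _ (trans (sym (reorder i)) e)))
      where
      reorder : ∀ i → (K * n + c) + suc i ≡ (K * n + suc i) + c
      reorder i = solve 3 (λ k c i → (k :+ c) :+ (con 1 :+ i) := (k :+ (con 1 :+ i)) :+ c) refl (K * n) c i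
      notMultiple : ∀ b → K * n + suc i ≢ K * b
      notMultiple b e with b ≤? n
      ... | yes b≤n = <⇒≱ (≤-trans (s≤s (m≤m+n (K * n) i)) (≤-reflexive (trans (sym (+-suc (K * n) i)) e))) (*-monoʳ-≤ K b≤n)
      ... | no  b≰n = <⇒≱ (≤-trans (+-monoʳ-< (K * n) (s≤s (≤∧≢⇒< i≤m i≢m))) (≤-reflexive (trans (+-comm (K * n) K) (sym (*-suc K n)))))
                          (≤-trans (*-monoʳ-≤ K (≰⇒> b≰n)) (≤-reflexive (sym e)))

  walkOfWeight : Bool → ℕ → ℕ → List Move → ℕ
  walkOfWeight t h j v = ⟦ isWalk 0 0 v h ⟧ * ⟦ weight t v ≡ᵇ j ⟧

  walks : Bool → ℕ → ℕ → ℕ → ℕ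
  walks t h j n = sumMoveWords (K * n + h) (walkOfWeight t h j)

  peaks-isWalk₀ : ∀ R e → isWalk 0 0 R e ≡ true → peaks true R ≡ peaks false R
  peaks-isWalk₀ []          e _ = refl
  peaks-isWalk₀ (up ∷ R)    e _ = refl
  peaks-isWalk₀ (down ∷ R)  e ()

  weight-++-up : ∀ t P R e → isWalk 0 0 R e ≡ true → weight t (P ++ up ∷ R) ≡ peaks false P + weight t R
  weight-++-up false P R e walk = trans (peaks-++ false P (up ∷ R)) (cong (peaks false P +_) (peaks-isWalk₀ R e walk))
  weight-++-up true  P R e walk =
    trans (cong₂ _+_ (trans (peaks-++ false P (up ∷ R)) (cong (peaks false P +_) (peaks-isWalk₀ R e walk)))
                     (cong ⟦_⟧ (endsUp-++ true P (up ∷ R))))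
          (+-assoc (peaks false P) _ _)

  walkOfWeight-++-up : ∀ t c e j P R →
    ⟦ isWalk 0 0 P c ⟧ * ⟦ isWalk 0 0 R e ⟧ * ⟦ weight t (P ++ up ∷ R) ≡ᵇ j ⟧
      ≡ sum≤ j (λ a → walkOfWeight false c a P * walkOfWeight t e (j ∸ a) R)
  walkOfWeight-++-up t c e j P R with isWalk 0 0 R e in walk
  ... | false = trans (cong (_* ⟦ weight t (P ++ up ∷ R) ≡ᵇ j ⟧) (*-zeroʳ ⟦ isWalk 0 0 P c ⟧))
                      (sym (sum≤-zero j (λ a _ → *-zeroʳ (walkOfWeight false c a P))))
  ... | true =
    begin
      ⟦ isWalk 0 0 P c ⟧ * 1 * ⟦ weight t (P ++ up ∷ R) ≡ᵇ j ⟧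
    ≡⟨ cong₂ (λ x y → x * ⟦ y ≡ᵇ j ⟧) (*-identityʳ ⟦ isWalk 0 0 P c ⟧) (weight-++-up t P R e walk) ⟩
      ⟦ isWalk 0 0 P c ⟧ * ⟦ peaks false P + weight t R ≡ᵇ j ⟧
    ≡⟨ cong (⟦ isWalk 0 0 P c ⟧ *_) (⟦+≡ᵇ⟧-convolution (peaks false P) (weight t R) j) ⟩
      ⟦ isWalk 0 0 P c ⟧ * sum≤ j (λ a → ⟦ peaks false P ≡ᵇ a ⟧ * ⟦ weight t R ≡ᵇ j ∸ a ⟧)
    ≡⟨ sym (sum≤-*ˡ j ⟦ isWalk 0 0 P c ⟧ (λ a → ⟦ peaks false P ≡ᵇ a ⟧ * ⟦ weight t R ≡ᵇ j ∸ a ⟧)) ⟩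
      sum≤ j (λ a → ⟦ isWalk 0 0 P c ⟧ * (⟦ peaks false P ≡ᵇ a ⟧ * ⟦ weight t R ≡ᵇ j ∸ a ⟧))
    ≡⟨ sum≤-cong j (λ a _ → trans (sym (*-assoc ⟦ isWalk 0 0 P c ⟧ _ _))
                                  (cong (walkOfWeight false c a P *_) (sym (*-identityˡ ⟦ weight t R ≡ᵇ j ∸ a ⟧)))) ⟩
      sum≤ j (λ a → walkOfWeight false c a P * (1 * ⟦ weight t R ≡ᵇ j ∸ a ⟧))
    ∎
    where open ≡-Reasoning

  sum≤-walks-convolution : ∀ t c e a j n →
    sum≤ ((K * n + c) + e) (λ i → sumMoveWords i (walkOfWeight false c a) * sumMoveWords ((K * n + c) + e ∸ i) (walkOfWeight t e j))
      ≡ sum≤ n (λ b → walks false c a b * walks t e j (n ∸ b))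
  sum≤-walks-convolution t c e a j n =
    begin
      sum≤ ((K * n + c) + e) f
    ≡⟨ sum≤-vanishingTail (K * n + c) e f suffixTooShort ⟩
      sum≤ (K * n + c) f
    ≡⟨ sum≤-progression c n f (λ i off → cong (_* sumMoveWords ((K * n + c) + e ∸ i) (walkOfWeight t e j))
                                              (sumMoveWords-isWalk-offProgression c i _ off)) ⟩
      sum≤ n (λ b → f (K * b + c))
    ≡⟨ sum≤-cong n (λ b b≤n → cong (λ z → walks false c a b * sumMoveWords z (walkOfWeight t e j)) (complement b b≤n)) ⟩
      sum≤ n (λ b → walks false c a b * walks t e j (n ∸ b))
    ∎
    where
    open ≡-Reasoning
    f : ℕ → ℕ
    f i = sumMoveWords i (walkOfWeight false c a) * sumMoveWords ((K * n + c) + e ∸ i) (walkOfWeight t e j)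
    suffixTooShort : ∀ i → i < e → f ((K * n + c) + suc i) ≡ 0
    suffixTooShort i i<e =
      trans (cong (sumMoveWords ((K * n + c) + suc i) (walkOfWeight false c a) *_)
                  (sumMoveWords-isWalk-short e _ (λ R → ⟦ weight t R ≡ᵇ j ⟧)
                    (subst (_< e) (sym ([m+n]∸[m+o]≡n∸o (K * n + c) e (suc i))) (∸-monoʳ-< {e} {suc i} {0} (s≤s z≤n) i<e))))
            (*-zeroʳ (sumMoveWords ((K * n + c) + suc i) (walkOfWeight false c a)))
    complement : ∀ b → b ≤ n → (K * n + c) + e ∸ (K * b + c) ≡ K * (n ∸ b) + e
    complement b b≤n = trans (cong (λ z → (K * z + c) + e ∸ (K * b + c)) (sym (m+[n∸m]≡n b≤n)))
                             (trans (cong (_∸ (K * b + c)) (rearrange (n ∸ b))) (m+n∸m≡n (K * b + c) _))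
      where
      rearrange : ∀ s → (K * (b + s) + c) + e ≡ (K * b + c) + (K * s + e)
      rearrange s = solve 5 (λ k b s c e → (k :* (b :+ s) :+ c) :+ e := (k :* b :+ c) :+ (k :* s :+ e)) refl K b s c e

  walks-concat : ∀ t c e j n → walks t (suc c + e) j n ≡ sum≤ j (λ a → sum≤ n (λ b → walks false c a b * walks t e (j ∸ a) (n ∸ b)))
  walks-concat t c e j n =
    begin
      sumMoveWords (K * n + suc (c + e)) (walkOfWeight t (suc c + e) j)
    ≡⟨ cong (λ z → sumMoveWords z (walkOfWeight t (suc c + e) j)) (trans (+-suc (K * n) (c + e)) (cong suc (sym (+-assoc (K * n) c e)))) ⟩
      sumMoveWords (suc ℓ) (walkOfWeight t (suc c + e) j)
    ≡⟨ sumMoveWords-cong (suc ℓ) (λ w _ → splitAtLastVisit w) ⟩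
      sumMoveWords (suc ℓ) (λ w → sum≤ j (λ a → sumUpSplits (splitTerm a) w))
    ≡⟨ sumMoveWords-sum≤ (suc ℓ) j (λ a → sumUpSplits (splitTerm a)) ⟩
      sum≤ j (λ a → sumMoveWords (suc ℓ) (sumUpSplits (splitTerm a)))
    ≡⟨ sum≤-cong j (λ a _ → trans (sumMoveWords-sumUpSplits ℓ (walkOfWeight false c a) (walkOfWeight t e (j ∸ a)))
                                  (sum≤-walks-convolution t c e a (j ∸ a) n)) ⟩
      sum≤ j (λ a → sum≤ n (λ b → walks false c a b * walks t e (j ∸ a) (n ∸ b)))
    ∎
    where
    open ≡-Reasoning
    ℓ = (K * n + c) + e
    splitTerm : ℕ → List Move → List Move → ℕ
    splitTerm a P R = walkOfWeight false c a P * walkOfWeight t e (j ∸ a) R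
    splitAtLastVisit : ∀ w → walkOfWeight t (suc c + e) j w ≡ sum≤ j (λ a → sumUpSplits (splitTerm a) w)
    splitAtLastVisit w =
      trans (isWalk-lastVisit c e w 0 (λ w → ⟦ weight t w ≡ᵇ j ⟧))
      (trans (+-identityʳ _)
      (trans (sumUpSplits-cong w (walkOfWeight-++-up t c e j))
             (sumUpSplits-sum≤ w j splitTerm)))

  walkSeries : Bool → ℕ → Series
  walkSeries t h j n = pos (walks t h j n)

  G : Series
  G = walkSeries false 0

  walkSeries-concat : ∀ t c e → (walkSeries false c ⊛ walkSeries t e) ≐ walkSeries t (suc c + e)
  walkSeries-concat t c e j n =
    trans (sumTo-cong j (λ a _ → trans (sumTo-cong n (λ b _ → sym (ℤ.pos-* (walks false c a b) (walks t e (j ∸ a) (n ∸ b)))))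
                                       (sym (sum≤-toℤ n (λ b → walks false c a b * walks t e (j ∸ a) (n ∸ b))))))
    (trans (sym (sum≤-toℤ j (λ a → sum≤ n (λ b → walks false c a b * walks t e (j ∸ a) (n ∸ b)))))
           (cong pos (sym (walks-concat t c e j n))))

  walkSeries-pow : ∀ h → walkSeries false h ≐ powS G (suc h)
  walkSeries-pow zero    j n = sym (⊛-identityʳ G j n)
  walkSeries-pow (suc h) j n = trans (sym (walkSeries-concat false 0 h j n)) (⊛-cong {G} {G} (λ _ _ → refl) (walkSeries-pow h) j n)

  walkSeries-endsUp : ∀ h → walkSeries true (suc h) ≐ (powS G (suc h) ⊛ walkSeries true 0)
  walkSeries-endsUp h j n =
    trans (cong (λ z → walkSeries true (suc z) j n) (sym (+-identityʳ h)))
    (trans (sym (walkSeries-concat true h 0 j n))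
           (⊛-cong {G = walkSeries true 0} {G′ = walkSeries true 0} (walkSeries-pow h) (λ _ _ → refl) j n))

  isWalk-to0-endsDown : ∀ x v b → isWalk 0 x v 0 ≡ true → v ≡ [] ⊎ endsUp b v ≡ false
  isWalk-to0-endsDown x []         b _    = inj₁ refl
  isWalk-to0-endsDown x (up ∷ v)   b walk with isWalk-to0-endsDown (suc x) v true walk
  ... | inj₁ refl = ⊥-elim (false≢true walk)
  ... | inj₂ endsDown = inj₂ endsDown
  isWalk-to0-endsDown x (down ∷ v) b walk with m ≤ᵇ x
  ... | false = ⊥-elim (false≢true walk)
  ... | true with isWalk-to0-endsDown (x ∸ m) v false walk
  ...   | inj₁ refl = inj₂ refl
  ...   | inj₂ endsDown = inj₂ endsDown

  walks-endsUp-0 : ∀ j n → walks true 0 j (suc n) ≡ walks false 0 j (suc n)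
  walks-endsUp-0 j n = sumMoveWords-cong (K * suc n + 0) same
    where
    same : ∀ v → length v ≡ K * suc n + 0 → walkOfWeight true 0 j v ≡ walkOfWeight false 0 j v
    same v len with isWalk 0 0 v 0 in walk
    ... | false = refl
    ... | true with isWalk-to0-endsDown 0 v true walk
    ...   | inj₁ refl = ⊥-elim (0≢1+n len)
    ...   | inj₂ endsDown rewrite endsDown | +-identityʳ (peaks false v) = refl

  walkSeries-endsUp-0 : walkSeries true 0 ≐ (G ⊖ oneS ⊕ tS)
  walkSeries-endsUp-0 j zero rewrite *-zeroʳ K with j
  ... | zero        = refl
  ... | suc zero    = refl
  ... | suc (suc j) = refl
  walkSeries-endsUp-0 j (suc n) rewrite walks-endsUp-0 j n with j
  ... | zero        = sym (trans (ℤ.+-identityʳ _) (ℤ.+-identityʳ _))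
  ... | suc zero    = sym (trans (ℤ.+-identityʳ _) (ℤ.+-identityʳ _))
  ... | suc (suc j) = sym (trans (ℤ.+-identityʳ _) (ℤ.+-identityʳ _))

  walkSeries-endsUp-formula : ∀ h → walkSeries true (suc h) ≐ (powS G (suc h) ⊛ (G ⊖ oneS ⊕ tS))
  walkSeries-endsUp-formula h j n =
    trans (walkSeries-endsUp h j n) (⊛-cong {powS G (suc h)} {powS G (suc h)} (λ _ _ → refl) walkSeries-endsUp-0 j n)

  isWalk-snoc-up : ∀ x v → isWalk 0 x (v ++ up ∷ []) 0 ≡ false
  isWalk-snoc-up x []         = refl
  isWalk-snoc-up x (up ∷ v)   = isWalk-snoc-up (suc x) v
  isWalk-snoc-up x (down ∷ v) with m ≤ᵇ x
  ... | true  = isWalk-snoc-up (x ∸ m) v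
  ... | false = refl

  isWalk-snoc-down : ∀ x v → isWalk 0 x (v ++ down ∷ []) 0 ≡ isWalk 0 x v m
  isWalk-snoc-down x (up ∷ v)   = isWalk-snoc-down (suc x) v
  isWalk-snoc-down x (down ∷ v) with m ≤ᵇ x
  ... | true  = isWalk-snoc-down (x ∸ m) v
  ... | false = refl
  isWalk-snoc-down x [] with <-cmp x m
  ... | tri< x<m _ _ rewrite ≤ᵇ-false {m} {x} (<⇒≱ x<m) | ≡ᵇ-false {x} {m} (<⇒≢ x<m) = refl
  ... | tri≈ _ refl _ rewrite ≤ᵇ-true {m} {m} ≤-refl | n∸n≡0 m | ≡ᵇ-true {m} {m} refl = refl
  ... | tri> _ _ m<x rewrite ≤ᵇ-true {m} {x} (<⇒≤ m<x) | ≡ᵇ-false {x} {m} (λ e → <⇒≢ m<x (sym e))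
                           | ≡ᵇ-false {x ∸ m} {0} (λ e → <⇒≢ m<x (sym (trans (sym (m∸n+n≡m (<⇒≤ m<x))) (cong (_+ m) e)))) = refl

  endsUp-nonempty : ∀ v → v ≢ [] → endsUp false v ≡ endsUp true v
  endsUp-nonempty []         v≢[] = ⊥-elim (v≢[] refl)
  endsUp-nonempty (up ∷ v)   _    = refl
  endsUp-nonempty (down ∷ v) _    = refl

  -- A nonempty walk back to 0 ends with a down step; removing it leaves a walk to height m.
  walks-lastDown : ∀ j n → walks false 0 j (suc n) ≡ walks true m j n
  walks-lastDown j n =
    trans (cong (λ z → sumMoveWords z (walkOfWeight false 0 j)) length-suc)
    (trans (sumMoveWords-snoc (K * n + m) (walkOfWeight false 0 j))
    (trans (cong (_+ sumMoveWords (K * n + m) (λ v → walkOfWeight false 0 j (v ++ down ∷ []))) (sumMoveWords-zero (K * n + m) (λ v _ → cong (λ b → ⟦ b ⟧ * ⟦ peaks false (v ++ up ∷ []) ≡ᵇ j ⟧) (isWalk-snoc-up 0 v))))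
           (sumMoveWords-cong (K * n + m) (λ v _ → dropLast v))))
    where
    length-suc : K * suc n + 0 ≡ suc (K * n + m)
    length-suc = solve 2 (λ k n → (con 2 :+ k) :* (con 1 :+ n) :+ con 0 := con 1 :+ ((con 2 :+ k) :* n :+ (con 1 :+ k))) refl k n
    dropLast : ∀ v → walkOfWeight false 0 j (v ++ down ∷ []) ≡ walkOfWeight true m j v
    dropLast v rewrite isWalk-snoc-down 0 v with isWalk 0 0 v m in walk
    ... | false = refl
    ... | true rewrite peaks-++ false v (down ∷ []) | endsUp-nonempty v (λ { refl → false≢true walk }) =
      cong (λ z → ⟦ peaks false v + z ≡ᵇ j ⟧ + 0) (+-identityʳ _)

  G-constant : ∀ j → G j 0 ≡ oneS j 0 +ℤ pos 0
  G-constant j rewrite *-zeroʳ K with j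
  ... | zero  = refl
  ... | suc j = refl

  G-equation : G ≐ (oneS ⊕ xS (powS G m ⊛ (G ⊖ oneS ⊕ tS)))
  G-equation j zero    = G-constant j
  G-equation j (suc n) =
    trans (cong pos (walks-lastDown j n))
    (trans (walkSeries-endsUp-formula k j n)
           (sym (trans (cong (_+ℤ (powS G m ⊛ (G ⊖ oneS ⊕ tS)) j n) (oneS-suc j)) (ℤ.+-identityˡ _))))
    where
    oneS-suc : ∀ j → oneS j (suc n) ≡ pos 0
    oneS-suc zero    = refl
    oneS-suc (suc j) = refl

-- Counting words over {U, D, L} through an encoding by words of moves

==S-sound : ∀ a b → (a ==S b) ≡ true → a ≡ b
==S-sound U U _ = refl
==S-sound D D _ = refl
==S-sound L L _ = refl
==S-sound U D ()
==S-sound U L ()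
==S-sound D U ()
==S-sound D L ()
==S-sound L U ()
==S-sound L D ()

_==ˢ_ : List Step → List Step → Bool
[]      ==ˢ []      = true
(a ∷ v) ==ˢ (b ∷ w) = (a ==S b) ∧ (v ==ˢ w)
_       ==ˢ _       = false

==ˢ-sound : ∀ v w → (v ==ˢ w) ≡ true → v ≡ w
==ˢ-sound []      []      _ = refl
==ˢ-sound (a ∷ v) (b ∷ w) e with ∧-true⁻¹ {a ==S b} e
... | a≡b , v≡w = cong₂ _∷_ (==S-sound a b a≡b) (==ˢ-sound v w v≡w)

==ˢ-refl : ∀ w → (w ==ˢ w) ≡ true
==ˢ-refl []      = refl
==ˢ-refl (U ∷ w) = ==ˢ-refl w
==ˢ-refl (D ∷ w) = ==ˢ-refl w
==ˢ-refl (L ∷ w) = ==ˢ-refl w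

sumStepWords : ℕ → (List Step → ℕ) → ℕ
sumStepWords ℓ f = sum (map f (words ℓ))

sum-map-concatMap : ∀ {A B : Set} (f : B → ℕ) (g : A → List B) xs →
  sum (map f (concatMap g xs)) ≡ sum (map (λ x → sum (map f (g x))) xs)
sum-map-concatMap f g []       = refl
sum-map-concatMap f g (x ∷ xs) =
  trans (cong sum (map-++ f (g x) (concatMap g xs)))
  (trans (sum-++ (map f (g x)) (map f (concatMap g xs))) (cong (sum (map f (g x)) +_) (sum-map-concatMap f g xs)))

sumStepWords-suc : ∀ ℓ f → sumStepWords (suc ℓ) f ≡ sumStepWords ℓ (λ w → f (U ∷ w) + (f (D ∷ w) + (f (L ∷ w) + 0)))
sumStepWords-suc ℓ f = sum-map-concatMap f (λ w → (U ∷ w) ∷ (D ∷ w) ∷ (L ∷ w) ∷ []) (words ℓ)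

sumStepWords-cong : ∀ ℓ {f g : List Step → ℕ} → (∀ w → length w ≡ ℓ → f w ≡ g w) → sumStepWords ℓ f ≡ sumStepWords ℓ g
sumStepWords-cong zero        f≗g = cong (_+ 0) (f≗g [] refl)
sumStepWords-cong (suc ℓ) {f} {g} f≗g =
  trans (sumStepWords-suc ℓ f)
  (trans (sumStepWords-cong ℓ (λ w e → cong₂ _+_ (f≗g (U ∷ w) (cong suc e))
                                                 (cong₂ _+_ (f≗g (D ∷ w) (cong suc e)) (cong (_+ 0) (f≗g (L ∷ w) (cong suc e))))))
         (sym (sumStepWords-suc ℓ g)))

sumStepWords-single : ∀ x → sumStepWords (length x) (λ w → ⟦ w ==ˢ x ⟧) ≡ 1
sumStepWords-single []      = refl
sumStepWords-single (U ∷ x) = trans (sumStepWords-suc (length x) _) (trans (sumStepWords-cong (length x) (λ w _ → +-identityʳ _)) (sumStepWords-single x))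
sumStepWords-single (D ∷ x) = trans (sumStepWords-suc (length x) _) (trans (sumStepWords-cong (length x) (λ w _ → +-identityʳ _)) (sumStepWords-single x))
sumStepWords-single (L ∷ x) = trans (sumStepWords-suc (length x) _) (trans (sumStepWords-cong (length x) (λ w _ → +-identityʳ _)) (sumStepWords-single x))

sum-map-sumMoveWords : ∀ {A : Set} (xs : List A) ℓ (F : A → List Move → ℕ) →
  sum (map (λ x → sumMoveWords ℓ (F x)) xs) ≡ sumMoveWords ℓ (λ v → sum (map (λ x → F x v) xs))
sum-map-sumMoveWords []       ℓ F = sym (sumMoveWords-zero ℓ (λ _ _ → refl))
sum-map-sumMoveWords (x ∷ xs) ℓ F =
  trans (cong (sumMoveWords ℓ (F x) +_) (sum-map-sumMoveWords xs ℓ F)) (sym (sumMoveWords-+ ℓ (F x) (λ v → sum (map (λ x → F x v) xs))))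

sum-map-*ʳ : ∀ {A : Set} (xs : List A) (g : A → ℕ) c → sum (map (λ x → g x * c) xs) ≡ sum (map g xs) * c
sum-map-*ʳ []       g c = refl
sum-map-*ʳ (x ∷ xs) g c = trans (cong (g x * c +_) (sum-map-*ʳ xs g c)) (sym (*-distribʳ-+ c (g x) _))

countLA-filterᵇ : ∀ j (p : List Step → Bool) ws → countLA j (filterᵇ p ws) ≡ sum (map (λ w → ⟦ p w ∧ (la w ≡ᵇ j) ⟧) ws)
countLA-filterᵇ j p []       = refl
countLA-filterᵇ j p (w ∷ ws) with p w
... | false = countLA-filterᵇ j p ws
... | true with la w ≡ᵇ j
...   | true  = cong suc (countLA-filterᵇ j p ws)
...   | false = countLA-filterᵇ j p ws

countLA-byEncoding : ∀ (p : List Step → Bool) j n ℓ (enc : List Move → List Step) (Q : List Move → ℕ) →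
  (Q≡ : ∀ v → length v ≡ ℓ → Q v ≡ ⟦ p (enc v) ∧ (la (enc v) ≡ᵇ j) ⟧) →
  (surjective : ∀ w → length w ≡ n → p w ≡ true → Σ (List Move) (λ v → length v ≡ ℓ × w ≡ enc v)) →
  (injective : ∀ v v′ → (enc v ==ˢ enc v′) ≡ (v ==ᵐ v′)) →
  (lengthOK : ∀ v → length v ≡ ℓ → Q v ≡ 0 ⊎ length (enc v) ≡ n) →
  countLA j (filterᵇ p (words n)) ≡ sumMoveWords ℓ Q
countLA-byEncoding p j n ℓ enc Q Q≡ surjective injective lengthOK =
  begin
    countLA j (filterᵇ p (words n))
  ≡⟨ countLA-filterᵇ j p (words n) ⟩
    sumStepWords n (λ w → ⟦ p w ∧ (la w ≡ᵇ j) ⟧)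
  ≡⟨ sumStepWords-cong n asPreimageSum ⟩
    sumStepWords n (λ w → sumMoveWords ℓ (λ v → ⟦ w ==ˢ enc v ⟧ * Q v))
  ≡⟨ sum-map-sumMoveWords (words n) ℓ (λ w v → ⟦ w ==ˢ enc v ⟧ * Q v) ⟩
    sumMoveWords ℓ (λ v → sumStepWords n (λ w → ⟦ w ==ˢ enc v ⟧ * Q v))
  ≡⟨ sumMoveWords-cong ℓ (λ v len → trans (sum-map-*ʳ (words n) (λ w → ⟦ w ==ˢ enc v ⟧) (Q v)) (imageOnce v len)) ⟩
    sumMoveWords ℓ Q
  ∎
  where
  open ≡-Reasoning
  imageOnce : ∀ v → length v ≡ ℓ → sumStepWords n (λ w → ⟦ w ==ˢ enc v ⟧) * Q v ≡ Q v
  imageOnce v len with lengthOK v len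
  ... | inj₁ Q≡0   rewrite Q≡0 = *-zeroʳ (sumStepWords n (λ w → ⟦ w ==ˢ enc v ⟧))
  ... | inj₂ len′ rewrite sym len′ | sumStepWords-single (enc v) = +-identityʳ (Q v)
  asPreimageSum : ∀ w → length w ≡ n → ⟦ p w ∧ (la w ≡ᵇ j) ⟧ ≡ sumMoveWords ℓ (λ v → ⟦ w ==ˢ enc v ⟧ * Q v)
  asPreimageSum w len with p w in pw
  ... | true with surjective w len pw
  ...   | v₀ , len₀ , refl = sym (begin
      sumMoveWords ℓ (λ v → ⟦ enc v₀ ==ˢ enc v ⟧ * Q v)
    ≡⟨ sumMoveWords-cong ℓ (λ v _ → cong (λ b → ⟦ b ⟧ * Q v) (injective v₀ v)) ⟩
      sumMoveWords ℓ (λ v → ⟦ v₀ ==ᵐ v ⟧ * Q v)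
    ≡⟨ cong (λ z → sumMoveWords z (λ v → ⟦ v₀ ==ᵐ v ⟧ * Q v)) (sym len₀) ⟩
      sumMoveWords (length v₀) (λ v → ⟦ v₀ ==ᵐ v ⟧ * Q v)
    ≡⟨ sumMoveWords-single v₀ Q ⟩
      Q v₀
    ≡⟨ trans (Q≡ v₀ len₀) (cong (λ b → ⟦ b ∧ (la (enc v₀) ≡ᵇ j) ⟧) pw) ⟩
      ⟦ la (enc v₀) ≡ᵇ j ⟧
    ∎)
  asPreimageSum w len | false = sym (sumMoveWords-zero ℓ outside)
    where
    outside : ∀ v → length v ≡ ℓ → ⟦ w ==ˢ enc v ⟧ * Q v ≡ 0
    outside v lenᵥ with w ==ˢ enc v in w≡
    ... | false = refl
    ... | true rewrite Q≡ v lenᵥ | sym (==ˢ-sound w (enc v) w≡) | pw = refl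

heightOK-DʳLD : ∀ r x Y → heightOK (suc x) (replicate r D ++ (L ∷ D ∷ Y)) ≡ (if suc r ≤ᵇ x then heightOK (x ∸ suc r) Y else false)
heightOK-DʳLD zero    zero    Y = refl
heightOK-DʳLD zero    (suc x) Y = refl
heightOK-DʳLD (suc r) zero    Y = stuck r
  where
  stuck : ∀ r → heightOK 0 (replicate r D ++ (L ∷ D ∷ Y)) ≡ false
  stuck zero    = refl
  stuck (suc r) = refl
heightOK-DʳLD (suc r) (suc x) Y = heightOK-DʳLD r x Y

heightOK-DʳL : ∀ r y → heightOK (suc y) (replicate r D ++ (L ∷ [])) ≡ (y ≡ᵇ r)
heightOK-DʳL zero    y       = refl
heightOK-DʳL (suc r) zero    = stuck r
  where
  stuck : ∀ r → heightOK 0 (replicate r D ++ (L ∷ [])) ≡ false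
  stuck zero    = refl
  stuck (suc r) = refl
heightOK-DʳL (suc r) (suc y) = heightOK-DʳL r y

noULLU-DʳLD : ∀ r Y → noULLU (replicate r D ++ (L ∷ D ∷ Y)) ≡ noULLU Y
noULLU-DʳLD zero    Y = refl
noULLU-DʳLD (suc r) Y = noULLU-DʳLD r Y

noULLU-DʳL : ∀ r X → noULLU (replicate r D ++ (L ∷ X)) ≡ noULLU (L ∷ X)
noULLU-DʳL zero    X = refl
noULLU-DʳL (suc r) X = noULLU-DʳL r X

noULLU-tail : ∀ c w → noULLU (c ∷ w) ≡ true → noULLU w ≡ true
noULLU-tail U []      e = refl
noULLU-tail U (U ∷ w) e = e
noULLU-tail U (D ∷ w) e = e
noULLU-tail D w       e = e
noULLU-tail L []      e = refl
noULLU-tail L (D ∷ w) e = e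
noULLU-tail L (L ∷ w) e = e

laGo-DʳLD : ∀ r Y → laGo 0 (replicate r D ++ (L ∷ D ∷ Y)) ≡ laGo 0 Y
laGo-DʳLD zero    Y = refl
laGo-DʳLD (suc r) Y = laGo-DʳLD r Y

laGo-DʳL : ∀ r → laGo 0 (replicate r D ++ (L ∷ [])) ≡ 0
laGo-DʳL zero    = refl
laGo-DʳL (suc r) = laGo-DʳL r

dropPrefix-DʳLD : ∀ r Y → dropPrefix (replicate r D ++ (L ∷ D ∷ [])) (replicate r D ++ (L ∷ D ∷ Y)) ≡ just Y
dropPrefix-DʳLD zero    Y = refl
dropPrefix-DʳLD (suc r) Y = dropPrefix-DʳLD r Y

isPrefix-DʳL : ∀ r X → isPrefix (replicate r D ++ (L ∷ [])) (replicate r D ++ (L ∷ X)) ≡ true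
isPrefix-DʳL zero    X = refl
isPrefix-DʳL (suc r) X = isPrefix-DʳL r X

==ˢ-Dʳ : ∀ r X Y → ((replicate r D ++ X) ==ˢ (replicate r D ++ Y)) ≡ (X ==ˢ Y)
==ˢ-Dʳ zero    X Y = refl
==ˢ-Dʳ (suc r) X Y = ==ˢ-Dʳ r X Y

closeRun-suc : ∀ r → closeRun (suc r) ≡ ⟦ 1 ≤ᵇ r ⟧
closeRun-suc zero    = refl
closeRun-suc (suc r) = refl

trailingUps : ℕ → List Move → ℕ
trailingUps r []         = r
trailingUps r (up ∷ v)   = trailingUps (suc r) v
trailingUps r (down ∷ v) = trailingUps 0 v

trailingUps-endsUp : ∀ r v → (1 ≤ᵇ trailingUps r v) ≡ endsUp (1 ≤ᵇ r) v
trailingUps-endsUp zero    []         = refl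
trailingUps-endsUp (suc r) []         = refl
trailingUps-endsUp r       (up ∷ v)   = trailingUps-endsUp (suc r) v
trailingUps-endsUp r       (down ∷ v) = trailingUps-endsUp 0 v

stripU-sound : ∀ w {a r} → stripU w ≡ (a , r) → w ≡ replicate a U ++ r
stripU-sound (U ∷ w) e with stripU w in e′
... | a′ , r′ with e
... | refl = cong (U ∷_) (stripU-sound w e′)
stripU-sound []      refl = refl
stripU-sound (D ∷ w) refl = refl
stripU-sound (L ∷ w) refl = refl

dropPrefix-sound : ∀ p r {r′} → dropPrefix p r ≡ just r′ → r ≡ p ++ r′
dropPrefix-sound []      r       refl = refl
dropPrefix-sound (a ∷ p) []      ()
dropPrefix-sound (a ∷ p) (b ∷ r) e with a ==S b in a≡b
... | true  = cong₂ _∷_ (sym (==S-sound a b a≡b)) (dropPrefix-sound p r e)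
... | false with e
...   | ()

isPrefix-sound : ∀ p x → isPrefix p x ≡ true → Σ (List Step) (λ r → x ≡ p ++ r)
isPrefix-sound []      x       _ = x , refl
isPrefix-sound (a ∷ p) (b ∷ x) e with ∧-true⁻¹ {a ==S b} e
... | a≡b , p≤x with isPrefix-sound p x p≤x
...   | r , refl = r , cong (_∷ (p ++ r)) (sym (==S-sound a b a≡b))

#U : List Step → ℕ
#U []      = 0
#U (U ∷ w) = suc (#U w)
#U (D ∷ w) = #U w
#U (L ∷ w) = #U w

#DL : List Step → ℕ
#DL []      = 0
#DL (U ∷ w) = #DL w
#DL (D ∷ w) = suc (#DL w)
#DL (L ∷ w) = suc (#DL w)

length≡#U+#DL : ∀ w → length w ≡ #U w + #DL w
length≡#U+#DL []      = refl
length≡#U+#DL (U ∷ w) = cong suc (length≡#U+#DL w)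
length≡#U+#DL (D ∷ w) = trans (cong suc (length≡#U+#DL w)) (sym (+-suc (#U w) (#DL w)))
length≡#U+#DL (L ∷ w) = trans (cong suc (length≡#U+#DL w)) (sym (+-suc (#U w) (#DL w)))

heightOK-balance : ∀ h w → heightOK h w ≡ true → h + #U w ≡ #DL w
heightOK-balance h       []      e = trans (+-identityʳ h) (≡ᵇ-true⁻¹ e)
heightOK-balance h       (U ∷ w) e = trans (+-suc h (#U w)) (heightOK-balance (suc h) w e)
heightOK-balance (suc h) (D ∷ w) e = cong suc (heightOK-balance h w e)
heightOK-balance (suc h) (L ∷ w) e = cong suc (heightOK-balance h w e)

#DL-DʳL : ∀ r X → #DL (replicate r D ++ (L ∷ X)) ≡ suc (r + #DL X)
#DL-DʳL zero    X = refl
#DL-DʳL (suc r) X = cong suc (#DL-DʳL r X)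

augShape : ℕ → List Move → Bool
augShape zero    []         = true
augShape zero    (_ ∷ _)    = false
augShape (suc n) []         = false
augShape (suc n) (up ∷ v)   = augShape (suc n) v
augShape (suc n) (down ∷ v) = augShape n v

augShape-downs : ∀ n v → augShape n v ≡ true → downs v ≡ n
augShape-downs zero    []         _ = refl
augShape-downs (suc n) (up ∷ v)   e = augShape-downs (suc n) v e
augShape-downs (suc n) (down ∷ v) e = cong suc (augShape-downs n v e)

augShape-complete : ∀ n v b → downs v ≡ n → endsUp b v ≡ false → augShape n v ≡ true
augShape-complete zero    []         b _ _    = refl
augShape-complete zero    (up ∷ v)   b e endsDown = ⊥-elim (false≢true (trans (sym endsDown) (noDowns v e)))
  where
  noDowns : ∀ v → downs v ≡ 0 → endsUp true v ≡ true
  noDowns []       _ = refl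
  noDowns (up ∷ v) e = noDowns v e
augShape-complete (suc n) (up ∷ v)   b e endsDown = augShape-complete (suc n) v true e endsDown
augShape-complete (suc n) (down ∷ v) b e endsDown = augShape-complete n v false (suc-injective e) endsDown

-- The encoding of m-Dyck walks, m = k + 1 ≥ 2, by skew Dyck words: up ↦ U, down ↦ U Dᵏ L D

module Encoding (k₀ : ℕ) where

  k : ℕ
  k = suc k₀

  open Walks k

  encode : List Step → List Move → List Step
  encode tl []         = tl
  encode tl (up ∷ v)   = U ∷ encode tl v
  encode tl (down ∷ v) = U ∷ (replicate k D ++ (L ∷ D ∷ encode tl v))

  heightOK-encode : ∀ tl E → (∀ y → heightOK y tl ≡ (y ≡ᵇ E)) → ∀ x v → heightOK x (encode tl v) ≡ isWalk 0 x v E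
  heightOK-encode tl E tl-ok x []         = tl-ok x
  heightOK-encode tl E tl-ok x (up ∷ v)   = heightOK-encode tl E tl-ok (suc x) v
  heightOK-encode tl E tl-ok x (down ∷ v) =
    trans (heightOK-DʳLD k x (encode tl v)) (cong (if m ≤ᵇ x then_else false) (heightOK-encode tl E tl-ok (x ∸ m) v))

  noULLU-encode : ∀ tl → noULLU tl ≡ true → noULLU (U ∷ tl) ≡ true → ∀ v → noULLU (encode tl v) ≡ true × noULLU (U ∷ encode tl v) ≡ true
  noULLU-encode tl ok Uok []         = ok , Uok
  noULLU-encode tl ok Uok (up ∷ v)   = proj₂ (noULLU-encode tl ok Uok v) , proj₂ (noULLU-encode tl ok Uok v)
  noULLU-encode tl ok Uok (down ∷ v) = trans (noULLU-DʳLD k₀ (encode tl v)) (proj₁ (noULLU-encode tl ok Uok v))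
                                     , trans (noULLU-DʳLD k₀ (encode tl v)) (proj₁ (noULLU-encode tl ok Uok v))

  -- A down move closes a long ascent exactly when it follows an up move.
  laGo-encode : ∀ tl r v → laGo r (encode tl v) ≡ peaks (1 ≤ᵇ r) v + laGo (trailingUps r v) tl
  laGo-encode tl r []         = refl
  laGo-encode tl r (up ∷ v)   = laGo-encode tl (suc r) v
  laGo-encode tl r (down ∷ v) =
    trans (cong₂ _+_ (closeRun-suc r) (trans (laGo-DʳLD k₀ (encode tl v)) (laGo-encode tl 0 v))) (sym (+-assoc ⟦ 1 ≤ᵇ r ⟧ _ _))

  encode-ups : ∀ tl a X → encode tl (replicate a up ++ X) ≡ replicate a U ++ encode tl X
  encode-ups tl zero    X = refl
  encode-ups tl (suc a) X = cong (U ∷_) (encode-ups tl a X)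

  length-encode : ∀ tl v → length (encode tl v) ≡ (length v + K * downs v) + length tl
  length-encode tl []         rewrite *-zeroʳ K = refl
  length-encode tl (up ∷ v)   = cong suc (length-encode tl v)
  length-encode tl (down ∷ v) =
    cong suc (trans (length-++ (replicate k D))
             (trans (cong₂ _+_ (length-replicate k) (cong (λ z → suc (suc z)) (length-encode tl v)))
                    (solve 4 (λ k l c t → k :+ (con 2 :+ ((l :+ (con 2 :+ k) :* c) :+ t)) := (l :+ (con 2 :+ k) :* (con 1 :+ c)) :+ t)
                             refl k (length v) (downs v) (length tl))))

  encode-injective : ∀ tl → (∀ b → (tl ==ˢ (U ∷ encode tl b)) ≡ false) → (∀ b → ((U ∷ encode tl b) ==ˢ tl) ≡ false)
    → (∀ b → (tl ==ˢ encode tl (down ∷ b)) ≡ false) → (∀ b → (encode tl (down ∷ b) ==ˢ tl) ≡ false)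
    → (∀ Y → (tl ==ˢ (D ∷ Y)) ≡ false) → (∀ Y → ((D ∷ Y) ==ˢ tl) ≡ false)
    → ∀ v v′ → (encode tl v ==ˢ encode tl v′) ≡ (v ==ᵐ v′)
  encode-injective tl tl≢Ub Ub≢tl tl≢db db≢tl tl≢DY DY≢tl = go
    where
    go : ∀ v v′ → (encode tl v ==ˢ encode tl v′) ≡ (v ==ᵐ v′)
    go []               []               = ==ˢ-refl tl
    go []               (up ∷ b)         = tl≢Ub b
    go []               (down ∷ b)       = tl≢db b
    go (up ∷ a)         []               = Ub≢tl a
    go (down ∷ a)       []               = db≢tl a
    go (up ∷ a)         (up ∷ b)         = go a b
    go (up ∷ [])        (down ∷ b)       = tl≢DY _
    go (up ∷ up ∷ a)    (down ∷ b)       = refl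
    go (up ∷ down ∷ a)  (down ∷ b)       = refl
    go (down ∷ a)       (up ∷ [])        = DY≢tl _
    go (down ∷ a)       (up ∷ up ∷ b)    = refl
    go (down ∷ a)       (up ∷ down ∷ b)  = refl
    go (down ∷ a)       (down ∷ b)       = trans (==ˢ-Dʳ k (L ∷ D ∷ encode tl a) (L ∷ D ∷ encode tl b)) (go a b)

  hasAugForm-UU : ∀ n Z → hasAugForm m (suc n) (U ∷ U ∷ Z) ≡ hasAugForm m (suc n) (U ∷ Z)
  hasAugForm-UU n Z with stripU Z
  ... | a , r = refl

  hasAugForm-encode : ∀ n v → hasAugForm m n (encode [] v) ≡ augShape n v
  hasAugForm-encode zero    []                = refl
  hasAugForm-encode zero    (up ∷ v)          = refl
  hasAugForm-encode zero    (down ∷ v)        = refl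
  hasAugForm-encode (suc n) []                = refl
  hasAugForm-encode (suc n) (down ∷ v)        rewrite dropPrefix-DʳLD k₀ (encode [] v) = hasAugForm-encode n v
  hasAugForm-encode (suc n) (up ∷ [])         = refl
  hasAugForm-encode (suc n) (up ∷ up ∷ v)     = trans (hasAugForm-UU n (encode [] v)) (hasAugForm-encode (suc n) (up ∷ v))
  hasAugForm-encode (suc n) (up ∷ down ∷ v)   =
    trans (hasAugForm-UU n (replicate k D ++ (L ∷ D ∷ encode [] v))) (hasAugForm-encode (suc n) (down ∷ v))

  augShape-ups : ∀ n a X → augShape (suc n) (replicate a up ++ X) ≡ augShape (suc n) X
  augShape-ups n zero    X = refl
  augShape-ups n (suc a) X = augShape-ups n a X

  hasAugForm-decode : ∀ n w → hasAugForm m n w ≡ true → Σ (List Move) (λ v → augShape n v ≡ true × w ≡ encode [] v)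
  hasAugForm-decode zero    []  _    = [] , refl , refl
  hasAugForm-decode (suc n) w   form with stripU w in w≡
  ... | zero  , r = ⊥-elim (false≢true form)
  ... | suc a , r with dropPrefix (augTail m) r in r≡
  ...   | nothing = ⊥-elim (false≢true form)
  ...   | just r′ with hasAugForm-decode n r′ form
  ...     | v′ , shape , refl =
    (replicate a up ++ (down ∷ v′)) , trans (augShape-ups n a (down ∷ v′)) shape ,
    (begin
      w
    ≡⟨ stripU-sound w w≡ ⟩
      replicate (suc a) U ++ r
    ≡⟨ cong (replicate (suc a) U ++_) (trans (dropPrefix-sound (augTail m) r r≡) (++-assoc (replicate k D) (L ∷ D ∷ []) (encode [] v′))) ⟩
      replicate (suc a) U ++ (replicate k D ++ (L ∷ D ∷ encode [] v′))
    ≡⟨ Uˢᵘᶜᶜ≡Uᵃ++U a (replicate k D ++ (L ∷ D ∷ encode [] v′)) ⟩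
      replicate a U ++ encode [] (down ∷ v′)
    ≡⟨ sym (encode-ups [] a (down ∷ v′)) ⟩
      encode [] (replicate a up ++ (down ∷ v′))
    ∎)
    where
    open ≡-Reasoning
    Uˢᵘᶜᶜ≡Uᵃ++U : ∀ a X → replicate (suc a) U ++ X ≡ replicate a U ++ (U ∷ X)
    Uˢᵘᶜᶜ≡Uᵃ++U zero    X = refl
    Uˢᵘᶜᶜ≡Uᵃ++U (suc a) X = cong (U ∷_) (Uˢᵘᶜᶜ≡Uᵃ++U a X)

  endsUp-false-isWalk-to0 : ∀ v → isWalk 0 0 v 0 ≡ true → endsUp false v ≡ false
  endsUp-false-isWalk-to0 v walk with isWalk-to0-endsDown 0 v false walk
  ... | inj₁ refl     = refl
  ... | inj₂ endsDown = endsDown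

  trailingUps-isWalk-to0 : ∀ v → isWalk 0 0 v 0 ≡ true → trailingUps 0 v ≡ 0
  trailingUps-isWalk-to0 v walk = noUps (trailingUps 0 v) (trans (trailingUps-endsUp 0 v) (endsUp-false-isWalk-to0 v walk))
    where
    noUps : ∀ x → (1 ≤ᵇ x) ≡ false → x ≡ 0
    noUps zero _ = refl

  countLA-augPaths : ∀ j n → countLA j (augPaths m n) ≡ walks false 0 j n
  countLA-augPaths j n =
    countLA-byEncoding (isAugPath m n) j (2 * (n * (m + 1))) (K * n + 0) (encode []) (walkOfWeight false 0 j)
                       weightOK decode (encode-injective [] (λ _ → refl) (λ _ → refl) (λ _ → refl) (λ _ → refl) (λ _ → refl) (λ _ → refl))
                       lengthOK
    where
    weightOK : ∀ v → length v ≡ K * n + 0 → walkOfWeight false 0 j v ≡ ⟦ isAugPath m n (encode [] v) ∧ (la (encode [] v) ≡ᵇ j) ⟧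
    weightOK v len rewrite proj₁ (noULLU-encode [] refl refl v) | heightOK-encode [] 0 (λ _ → refl) 0 v | hasAugForm-encode n v
      with isWalk 0 0 v 0 in walk
    ... | false = refl
    ... | true rewrite augShape-complete n v false (isWalk-downs v 0 n walk len) (endsUp-false-isWalk-to0 v walk)
                     | laGo-encode [] 0 v | trailingUps-isWalk-to0 v walk =
      trans (+-identityʳ _) (cong (λ z → ⟦ z ≡ᵇ j ⟧) (sym (+-identityʳ (peaks false v))))
    decode : ∀ w → length w ≡ 2 * (n * (m + 1)) → isAugPath m n w ≡ true → Σ (List Move) (λ v → length v ≡ K * n + 0 × w ≡ encode [] v)
    decode w _ aug with ∧-true⁻¹ {isSkewDyck w} aug
    ... | skew , form with ∧-true⁻¹ {noULLU w} skew | hasAugForm-decode n w form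
    ...   | _ , height | v , shape , refl = v , trans (isWalk-length 0 v 0 walk) (trans (cong (K *_) (augShape-downs n v shape)) (sym (+-identityʳ _))) , refl
      where
      walk : isWalk 0 0 v 0 ≡ true
      walk = trans (sym (heightOK-encode [] 0 (λ _ → refl) 0 v)) height
    lengthOK : ∀ v → length v ≡ K * n + 0 → walkOfWeight false 0 j v ≡ 0 ⊎ length (encode [] v) ≡ 2 * (n * (m + 1))
    lengthOK v len with isWalk 0 0 v 0 in walk
    ... | false = inj₁ refl
    ... | true  = inj₂ (trans (length-encode [] v) (trans (cong₂ (λ a b → (a + K * b) + 0) len (isWalk-downs v 0 n walk len))
                                                          (solve 2 (λ n k → (((con 3 :+ k) :* n :+ con 0) :+ (con 3 :+ k) :* n) :+ con 0
                                                                            := con 2 :* (n :* ((con 2 :+ k) :+ con 1))) refl n k₀)))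

  occ : List Step → ℕ
  occ = occurrences (boxFactor k)

  occ-DʳL : ∀ r X → occ (replicate r D ++ (L ∷ X)) ≡ occ X
  occ-DʳL zero    X = refl
  occ-DʳL (suc r) X = occ-DʳL r X

  occ-encode : ∀ v → occ (encode (boxFactor k) v) ≡ suc (downs v)
  occ-encode []              rewrite isPrefix-DʳL k₀ [] = cong suc (occ-DʳL k₀ [])
  occ-encode (up ∷ [])       = occ-encode []
  occ-encode (up ∷ up ∷ v)   = occ-encode (up ∷ v)
  occ-encode (up ∷ down ∷ v) = occ-encode (down ∷ v)
  occ-encode (down ∷ v)      rewrite isPrefix-DʳL k₀ (D ∷ encode (boxFactor k) v) =
    cong suc (trans (occ-DʳL k₀ (D ∷ encode (boxFactor k) v)) (occ-encode v))

  -- A box factor U Dᵏ L uses k + 1 of the D and L steps, and unless it ends the word it is followed by a D,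
  -- since LU is forbidden and LL would be followed by a U; equality in the bound forces the shape of an encoding.
  BoxBound : List Step → Set
  BoxBound w = (K * occ w ≤ suc (#DL w)) × (K * occ w ≡ suc (#DL w) → Σ (List Move) (λ v → w ≡ encode (boxFactor k) v))

  BoxBoundAfterU : List Step → Set
  BoxBoundAfterU w = (K * suc (occ w) ≤ suc (#DL w)) ×
                     (K * suc (occ w) ≡ suc (#DL w) → Σ (List Move) (λ v → U ∷ w ≡ encode (boxFactor k) v))

  boxBound-afterFactor : ∀ w₂ → (∀ w₃ → length w₃ < length w₂ → noULLU w₃ ≡ true → BoxBound w₃) →
    noULLU (L ∷ w₂) ≡ true → BoxBoundAfterU (replicate k D ++ (L ∷ w₂))
  boxBound-afterFactor w₂ IH ok rewrite occ-DʳL k w₂ | #DL-DʳL k w₂ = afterFactor w₂ IH ok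
    where
    afterFactor : ∀ w₂ → (∀ w₃ → length w₃ < length w₂ → noULLU w₃ ≡ true → BoxBound w₃) → noULLU (L ∷ w₂) ≡ true →
      (K * suc (occ w₂) ≤ suc (suc (k + #DL w₂))) ×
      (K * suc (occ w₂) ≡ suc (suc (k + #DL w₂)) → Σ (List Move) (λ v → U ∷ (replicate k D ++ (L ∷ w₂)) ≡ encode (boxFactor k) v))
    afterFactor []       _  _  = ≤-reflexive (trans (*-identityʳ K) (cong (λ z → suc (suc z)) (sym (+-identityʳ k)))) , (λ _ → [] , refl)
    afterFactor (U ∷ w₃) _  ()
    afterFactor (D ∷ w₃) IH ok with IH w₃ ≤-refl ok
    ... | bound , tight = subst (_≤ K + suc (#DL w₃)) (sym (*-suc K (occ w₃))) (+-monoʳ-≤ K bound)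
                        , (λ e → afterD (tight (+-cancelˡ-≡ K _ _ (trans (sym (*-suc K (occ w₃))) e))))
      where
      afterD : Σ (List Move) (λ v → w₃ ≡ encode (boxFactor k) v) → Σ (List Move) (λ v → U ∷ (replicate k D ++ (L ∷ D ∷ w₃)) ≡ encode (boxFactor k) v)
      afterD (v , refl) = (down ∷ v) , refl
    afterFactor (L ∷ w₃) IH ok with IH w₃ ≤-refl (noULLU-tail L w₃ ok)
    ... | bound , tight = subst (_≤ K + suc (#DL w₃)) (sym (*-suc K (occ w₃))) (+-monoʳ-≤ K bound)
                        , (λ e → afterL (tight (+-cancelˡ-≡ K _ _ (trans (sym (*-suc K (occ w₃))) e))))
      where
      afterL : Σ (List Move) (λ v → w₃ ≡ encode (boxFactor k) v) → Σ (List Move) (λ v → U ∷ (replicate k D ++ (L ∷ L ∷ w₃)) ≡ encode (boxFactor k) v)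
      afterL (v , refl) = ⊥-elim (false≢true (trans (sym (LLU v)) ok))
        where
        LLU : ∀ v → noULLU (L ∷ L ∷ encode (boxFactor k) v) ≡ false
        LLU []         = refl
        LLU (up ∷ v)   = refl
        LLU (down ∷ v) = refl

  boxBound : ∀ N w → length w < N → noULLU w ≡ true → BoxBound w
  boxBound (suc N) []      _         _  = subst (_≤ 1) (sym (*-zeroʳ K)) z≤n , (λ e → ⊥-elim (0≢1+n (trans (sym (*-zeroʳ K)) e)))
  boxBound (suc N) (D ∷ w) (s≤s len) ok with boxBound N w len ok
  ... | bound , _ = m≤n⇒m≤1+n bound , (λ e → ⊥-elim (<⇒≢ (s≤s bound) e))
  boxBound (suc N) (L ∷ w) (s≤s len) ok with boxBound N w len (noULLU-tail L w ok)
  ... | bound , _ = m≤n⇒m≤1+n bound , (λ e → ⊥-elim (<⇒≢ (s≤s bound) e))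
  boxBound (suc N) (U ∷ w) (s≤s len) ok with isPrefix (boxFactor k) (U ∷ w) in factor
  ... | false with boxBound N w len (noULLU-tail U w ok)
  ...   | bound , tight = bound , (λ e → afterU (tight e))
    where
    afterU : Σ (List Move) (λ v → w ≡ encode (boxFactor k) v) → Σ (List Move) (λ v → U ∷ w ≡ encode (boxFactor k) v)
    afterU (v , refl) = (up ∷ v) , refl
  boxBound (suc N) (U ∷ w) (s≤s len) ok | true with isPrefix-sound (boxFactor k) (U ∷ w) factor
  ... | w₂ , U∷w≡ = subst BoxBoundAfterU (sym w≡)
                          (boxBound-afterFactor w₂ (λ w₃ w₃<w₂ → boxBound N w₃ (≤-trans w₃<w₂ (≤-trans (n≤1+n _) (≤-trans w₂< (<⇒≤ len)))))
                                                   (trans (sym (noULLU-DʳL k w₂)) (subst (λ z → noULLU (U ∷ z) ≡ true) w≡ ok)))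
    where
    w≡ : w ≡ replicate k D ++ (L ∷ w₂)
    w≡ = trans (cong (λ { (_ ∷ z) → z ; [] → [] }) U∷w≡) (++-assoc (replicate k D) (L ∷ []) w₂)
    w₂< : suc (length w₂) ≤ length w
    w₂< = subst (suc (length w₂) ≤_) (sym (trans (cong length w≡) (trans (length-++ (replicate k D)) (cong (_+ suc (length w₂)) (length-replicate k)))))
                (m≤n+m (suc (length w₂)) k)

  boxSize : ∀ n → (k + 2) * suc n ≡ suc (K * n + suc k)
  boxSize n = solve 2 (λ k n → ((con 1 :+ k) :+ con 2) :* (con 1 :+ n) := con 1 :+ ((con 3 :+ k) :* n :+ (con 1 :+ (con 1 :+ k)))) refl k₀ n

  encodeBox-injective : ∀ v v′ → (encode (boxFactor k) v ==ˢ encode (boxFactor k) v′) ≡ (v ==ᵐ v′)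
  encodeBox-injective = encode-injective (boxFactor k) box≢Ub Ub≢box box≢db db≢box (λ _ → refl) (λ _ → refl)
    where
    box≢Ub : ∀ b → (boxFactor k ==ˢ (U ∷ encode (boxFactor k) b)) ≡ false
    box≢Ub []         = refl
    box≢Ub (up ∷ b)   = refl
    box≢Ub (down ∷ b) = refl
    Ub≢box : ∀ b → ((U ∷ encode (boxFactor k) b) ==ˢ boxFactor k) ≡ false
    Ub≢box []         = refl
    Ub≢box (up ∷ b)   = refl
    Ub≢box (down ∷ b) = refl
    box≢db : ∀ b → (boxFactor k ==ˢ encode (boxFactor k) (down ∷ b)) ≡ false
    box≢db b = ==ˢ-Dʳ k₀ (L ∷ []) (L ∷ D ∷ encode (boxFactor k) b)
    db≢box : ∀ b → (encode (boxFactor k) (down ∷ b) ==ˢ boxFactor k) ≡ false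
    db≢box b = ==ˢ-Dʳ k₀ (L ∷ D ∷ encode (boxFactor k) b) (L ∷ [])

  heightOK-boxFactor : ∀ y → heightOK y (boxFactor k) ≡ (y ≡ᵇ k)
  heightOK-boxFactor y = heightOK-DʳL k y

  decodeBoxPath : ∀ n w → length w ≡ 2 * ((k + 2) * suc n ∸ 1) → isBoxPath k (suc n) w ≡ true →
                  Σ (List Move) (λ v → length v ≡ K * n + k × w ≡ encode (boxFactor k) v)
  decodeBoxPath n w len box with ∧-true⁻¹ {isSkewDyck w} box
  ... | skew , count with ∧-true⁻¹ {noULLU w} skew
  ...   | ok , height with proj₂ (boxBound (suc (length w)) w ≤-refl ok) tight
    where
    #DL≡ : #DL w ≡ K * n + suc k
    #DL≡ = m+m≡n+n⇒m≡n (#DL w) (K * n + suc k)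
             (trans (cong (_+ #DL w) (sym (heightOK-balance 0 w height)))
             (trans (sym (length≡#U+#DL w))
             (trans len (trans (cong (λ z → 2 * (z ∸ 1)) (boxSize n)) (cong (K * n + suc k +_) (+-identityʳ _))))))
    tight : K * occ w ≡ suc (#DL w)
    tight = trans (cong (K *_) (≡ᵇ-true⁻¹ {occ w} {suc n} count))
                  (trans (solve 2 (λ k n → (con 3 :+ k) :* (con 1 :+ n) := con 1 :+ ((con 3 :+ k) :* n :+ (con 1 :+ (con 1 :+ k)))) refl k₀ n)
                         (cong suc (sym #DL≡)))
  ...     | v , refl = v , trans (isWalk-length 0 v k walk) (trans (+-comm k _) (cong (λ z → K * z + k) downs≡)) , refl
    where
    walk : isWalk 0 0 v k ≡ true
    walk = trans (sym (heightOK-encode (boxFactor k) k heightOK-boxFactor 0 v)) height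
    downs≡ : downs v ≡ n
    downs≡ = suc-injective (trans (sym (occ-encode v)) (≡ᵇ-true⁻¹ count))

  countLA-boxPaths : ∀ j n → countLA j (boxPaths k (suc n)) ≡ walks true k j n
  countLA-boxPaths j n =
    countLA-byEncoding (isBoxPath k (suc n)) j (2 * ((k + 2) * suc n ∸ 1)) (K * n + k) (encode (boxFactor k)) (walkOfWeight true k j)
                       weightOK (decodeBoxPath n) encodeBox-injective lengthOK
    where
    nonempty : ∀ v → isWalk 0 0 v k ≡ true → v ≢ []
    nonempty [] () refl
    weightOK : ∀ v → length v ≡ K * n + k → walkOfWeight true k j v ≡ ⟦ isBoxPath k (suc n) (encode (boxFactor k) v) ∧ (la (encode (boxFactor k) v) ≡ᵇ j) ⟧
    weightOK v len rewrite proj₁ (noULLU-encode (boxFactor k) (noULLU-DʳL k₀ []) (noULLU-DʳL k₀ []) v)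
                         | heightOK-encode (boxFactor k) k heightOK-boxFactor 0 v | occ-encode v | laGo-encode (boxFactor k) 0 v
      with isWalk 0 0 v k in walk
    ... | false = refl
    ... | true rewrite isWalk-downs v k n walk len | ≡ᵇ-true {n} {n} refl | closeRun-suc (trailingUps 0 v) | laGo-DʳL k₀
                     | trailingUps-endsUp 0 v | endsUp-nonempty v (nonempty v walk) | +-identityʳ ⟦ endsUp true v ⟧ = +-identityʳ _
    lengthOK : ∀ v → length v ≡ K * n + k → walkOfWeight true k j v ≡ 0 ⊎ length (encode (boxFactor k) v) ≡ 2 * ((k + 2) * suc n ∸ 1)
    lengthOK v len with isWalk 0 0 v k in walk
    ... | false = inj₁ refl
    ... | true  = inj₂ (trans (length-encode (boxFactor k) v)
                       (trans (cong₂ (λ a b → (a + K * b) + length (boxFactor k)) len (isWalk-downs v k n walk len))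
                       (trans (cong (((K * n + k) + K * n) +_) (cong suc (trans (length-++ (replicate k D)) (cong (_+ 1) (length-replicate k)))))
                       (trans (solve 2 (λ k n → (((con 3 :+ k) :* n :+ (con 1 :+ k)) :+ (con 3 :+ k) :* n) :+ (con 1 :+ ((con 1 :+ k) :+ con 1))
                                               := con 2 :* ((con 3 :+ k) :* n :+ (con 1 :+ (con 1 :+ k)))) refl k₀ n)
                              (cong (λ z → 2 * (z ∸ 1)) (sym (boxSize n)))))))

module _ (k₀ : ℕ) where

  open Walks (suc k₀)
  open Encoding k₀

  Gser≐G : Gser m ≐ G
  Gser≐G j n = cong pos (countLA-augPaths j n)

  Gser-equation : Gser m ≐ (oneS ⊕ xS (powS (Gser m) m ⊛ (Gser m ⊖ oneS ⊕ tS)))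
  Gser-equation j n =
    trans (Gser≐G j n)
    (trans (G-equation j n)
           (cong (oneS j n +ℤ_) (sym (xS-cong (powS-⊛-⊖oneS⊕tS-cong Gser≐G m) j n))))

  Fser-equation : Fser k ≐ xS (powS (Gser m) k ⊛ (Gser m ⊖ oneS ⊕ tS))
  Fser-equation j zero    = refl
  Fser-equation j (suc n) =
    trans (cong pos (countLA-boxPaths j n))
    (trans (walkSeries-endsUp-formula k₀ j n)
           (sym (powS-⊛-⊖oneS⊕tS-cong Gser≐G k j n)))

lemma7p1 : ((m : ℕ) → 2 ≤ m → (j n : ℕ) →
             Gser m j n ≡ (oneS ⊕ xS (powS (Gser m) m ⊛ (Gser m ⊖ oneS ⊕ tS))) j n)
         × ((k : ℕ) → 1 ≤ k → (j n : ℕ) →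
             Fser k j n ≡ xS (powS (Gser (k + 1)) k ⊛ (Gser (k + 1) ⊖ oneS ⊕ tS)) j n)
lemma7p1 = augmented , boxes
  where
  augmented : (m : ℕ) → 2 ≤ m → (j n : ℕ) → Gser m j n ≡ (oneS ⊕ xS (powS (Gser m) m ⊛ (Gser m ⊖ oneS ⊕ tS))) j n
  augmented (suc (suc k₀)) (s≤s (s≤s z≤n)) = Gser-equation k₀
  boxes : (k : ℕ) → 1 ≤ k → (j n : ℕ) → Fser k j n ≡ xS (powS (Gser (k + 1)) k ⊛ (Gser (k + 1) ⊖ oneS ⊕ tS)) j n
  boxes (suc k₀) (s≤s z≤n) rewrite +-comm k₀ 1 = Fser-equation k₀
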